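{- For each pair $\{\sigma_1,\sigma_2\}\in\{\{1234,3214\}, \{4321,4123\}, \{4321,2341\}, \{1234,1432\}\}$, the set $S_n(\sigma_1, \sigma_2)$ is sign-balanced for every integer $n>1$.
   Context: For $\sigma\in S_k$, $\pi\in S_n$ (one-line notation), $k\le n$, $\pi$ contains $\sigma$ if there are indices $i_1<\cdots<i_k$ with $\pi_{i_s}>\pi_{i_t}$ iff $\sigma_s>\sigma_t$ for all $s<t$; otherwise $\pi$ avoids $\sigma$. $S_n(\sigma_1,\ldots,\sigma_r)$ is the set of permutations in $S_n$ avoiding every $\sigma_j$. A permutation is even (odd) if its number of inversions (pairs $i<j$ with $\pi_i>\pi_j$) is even (odd). A set of permutations is sign-balanced if it contains equally many even and odd permutations. -}

module Defs where

open import Data.Nat using (ℕ; zero; suc; _+_; _<_; _<ᵇ_; _≡ᵇ_)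
open import Data.Bool using (Bool; true; false; _∧_; _∨_; not; if_then_else_)
open import Data.Fin using (Fin; toℕ)
open import Data.Fin.Properties using (all?; any?)
open import Data.List using (List; []; _∷_; map; concatMap; filter; length; allFin)
open import Data.Nat.ListAction using (sum)
open import Relation.Binary.PropositionalEquality using (_≡_)
open import Data.Vec.Functional using (Vector)
open import Relation.Nullary.Decidable using (does)
open import Relation.Unary using (Decidable)
open import Data.Bool.Properties using (T?)

Word : ℕ → Set
Word n = Fin n → ℕ

_<?ᵇ_ : ℕ → ℕ → Bool
_<?ᵇ_ = _<ᵇ_

allᵇ : ∀ {n} → (Fin n → Bool) → Bool
allᵇ {n} p = does (all? {n} (λ i → T? (p i)))

anyᵇ : ∀ {n} → (Fin n → Bool) → Bool
anyᵇ {n} p = does (any? {n} (λ i → T? (p i)))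

allFuns : (n m : ℕ) → List (Fin n → Fin m)
allFuns zero m = (λ ()) ∷ []
allFuns (suc n) m =
  concatMap (λ f → map (λ x → cons x f) (allFin m)) (allFuns n m)
  where
  cons : Fin m → (Fin n → Fin m) → Fin (suc n) → Fin m
  cons x f Fin.zero = x
  cons x f (Fin.suc i) = f i

-- π : Fin n → Fin n is a permutation (in one-line notation) iff it is injective.
isPermᵇ : ∀ {n} → (Fin n → Fin n) → Bool
isPermᵇ π = allᵇ λ i → allᵇ λ j → (toℕ i ≡ᵇ toℕ j) ∨ not (toℕ (π i) ≡ᵇ toℕ (π j))

S : (n : ℕ) → List (Fin n → Fin n)
S n = filter (λ π → T? (isPermᵇ π)) (allFuns n n)

occursAtᵇ : ∀ {k n} → Word k → Word n → (Fin k → Fin n) → Bool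
occursAtᵇ σ π ι =
  allᵇ λ s → allᵇ λ t →
    not (toℕ s <ᵇ toℕ t)
    ∨ ((toℕ (ι s) <ᵇ toℕ (ι t))
       ∧ ((π (ι t) <ᵇ π (ι s)) ≡ᵇool (σ t <ᵇ σ s)))
  where
  _≡ᵇool_ : Bool → Bool → Bool
  true ≡ᵇool b = b
  false ≡ᵇool b = not b

containsᵇ : ∀ {k n} → Word k → Word n → Bool
containsᵇ {k} {n} σ π = go (allFuns k n)
  where
  go : List (Fin k → Fin n) → Bool
  go [] = false
  go (ι ∷ ιs) = occursAtᵇ σ π ι ∨ go ιs

Contains : ∀ {k n} → Word k → Word n → Set
Contains σ π = Data.Bool.T (containsᵇ σ π)

Avoids : ∀ {k n} → Word k → Word n → Set
Avoids σ π = Data.Bool.T (not (containsᵇ σ π))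

inv : ∀ {n} → (Fin n → Fin n) → ℕ
inv {n} π = sum (map (λ i → sum (map (λ j →
  if (toℕ i <ᵇ toℕ j) ∧ (toℕ (π j) <ᵇ toℕ (π i)) then 1 else 0) (allFin n))) (allFin n))

even? : ℕ → Bool
even? zero = true
even? (suc m) = not (even? m)

word : ∀ {n} → (Fin n → Fin n) → Word n
word π i = toℕ (π i)

Sav : (n : ℕ) → ∀ {k} → Word k → Word k → List (Fin n → Fin n)
Sav n σ₁ σ₂ = filter (λ π → T? (not (containsᵇ σ₁ (word π)) ∧ not (containsᵇ σ₂ (word π)))) (S n)

SignBalanced : ∀ {n} → List (Fin n → Fin n) → Set
SignBalanced A =
  length (filter (λ π → T? (even? (inv π))) A)
    ≡ length (filter (λ π → T? (not (even? (inv π)))) A)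

pat : ℕ → ℕ → ℕ → ℕ → Word 4
pat a b c d Fin.zero = a
pat a b c d (Fin.suc Fin.zero) = b
pat a b c d (Fin.suc (Fin.suc Fin.zero)) = c
pat a b c d (Fin.suc (Fin.suc (Fin.suc Fin.zero))) = d

-- Deleting the maximum n from π ∈ S_n(1234, 3214) leaves τ ∈ S_{n-1}(1234, 3214), and n can be put
-- back into τ exactly at the positions p whose prefix τ_1 … τ_p contains no monotone triple: an
-- occurrence of 1234 or 3214 through n must end at n, and a monotone triple before n creates one.
-- By Erdős–Szekeres p ≤ 4, and inserting n at p multiplies the sign by (-1)^(n-1-p). Hence the
-- signed count of S_n(1234, 3214), weighted by a function W of the inversions among the first four
-- entries, is ±(signed count of S_{n-1}(1234, 3214) weighted by transfer W). The weights 1, W₂, W₃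
-- are sent to W₂, 1 + W₃, W₃, and all three weighted counts vanish for n = 4, so the plain signed
-- count vanishes for every n ≥ 4; n = 2, 3 are checked by computation. Reversal and complement carry
-- {1234, 3214} to the other three pairs and multiply all signs by a common constant.

module Submission where

open import Defs
open import Data.Nat as ℕ using (ℕ; zero; suc; _∸_; _<_; _≤_; _<ᵇ_; _≡ᵇ_; z≤n; s≤s)
open import Data.Nat.Properties
  using (<ᵇ⇒<; <⇒<ᵇ; n≤1+n; ≡ᵇ⇒≡; ≡⇒≡ᵇ; n<1+n; <-irrefl; ≰⇒>; <⇒≱; <⇒≯; <-trans; <-≤-trans; ≤-<-trans; ≤-trans;
         <-cmp; ≤∧≢⇒<; ≮⇒≥; ∸-monoʳ-<; ∸-monoʳ-≤)
import Data.Nat.Properties as ℕ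
import Data.Nat.ListAction as ListAction
import Algebra.Properties.CommutativeMonoid.Sum as CommutativeMonoidSum
open import Data.Fin.Permutation using (reverse)
open import Data.Product using (_×_)

open import Data.Bool using (Bool; true; false; T; _∧_; _∨_; not; _xor_; if_then_else_)
import Data.Bool.Properties as Bool
open import Data.Bool.Properties using (T?; T-∧; T-∨; T-≡; T-not-≡; ∧-identityʳ; ∧-zeroʳ)
open import Data.Empty using (⊥-elim)
open import Data.Fin.Patterns using (0F; 1F; 2F; 3F; 4F)
open import Data.Fin using (Fin; zero; suc; toℕ; fromℕ; opposite; inject₁; punchIn; punchOut; pinch)
  renaming (_<_ to _<ᶠ_)
open import Data.Fin.Properties
  using (all?; _≟_; ¬∀⟶∃¬; toℕ-injective; toℕ-inject₁; toℕ-fromℕ; fromℕ≢inject₁; inject₁-injective;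
         punchOut-punchIn; punchIn-punchOut; punchInᵢ≢i; punchOut-cong; punchOut-injective; punchIn-injective;
         pinch-injective; pigeonhole; punchIn-cancel-≤; punchOut-cancel-≤; punchIn-mono-≤; toℕ<n; any?;
         opposite-prop; opposite-involutive)
open import Data.Integer as ℤ using (ℤ; 0ℤ; 1ℤ; _+_; _-_; _*_)
import Data.Integer.Properties as ℤ
open import Data.Integer.Tactic.RingSolver using (solve-∀)
open import Data.List using (List; []; _∷_; _++_; map; concatMap; filter; length; allFin; tabulate)
open import Data.Unit using (tt)
open import Data.List.Relation.Unary.Any as Any using (Any; here; there)
open import Data.List.Properties using (map-tabulate)
open import Data.Product using (∃; _,_; proj₁; proj₂)
open import Data.Sum using (_⊎_; inj₁; inj₂; swap; [_,_])
open import Function using (_∘_; _⇔_; mk⇔; Equivalence; Injective)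
open import Relation.Binary.PropositionalEquality hiding ([_])
open import Relation.Binary using (tri<; tri≈; tri>)
open import Relation.Nullary using (Dec; yes; no; ¬_)
open import Relation.Nullary.Decidable using (does; True; toWitness)
open ≡-Reasoning

true≢false : true ≢ false
true≢false ()

T-injective : ∀ {a b} → T a ⇔ T b → a ≡ b
T-injective {false} {false} _ = refl
T-injective {false} {true}  e = ⊥-elim (Equivalence.from e tt)
T-injective {true}  {false} e = ⊥-elim (Equivalence.to e tt)
T-injective {true}  {true}  _ = refl

T-not : ∀ {b} → T (not b) ⇔ (¬ T b)
T-not {false} = mk⇔ (λ _ ()) (λ _ → tt)
T-not {true}  = mk⇔ (λ ()) (λ ¬t → ¬t tt)

T-not∧not : ∀ {a b} → T (not a ∧ not b) ⇔ (¬ T a × ¬ T b)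
T-not∧not {a} {b} = mk⇔
  (λ t → let na , nb = Equivalence.to (T-∧ {not a}) t in Equivalence.to T-not na , Equivalence.to T-not nb)
  (λ (¬a , ¬b) → Equivalence.from T-∧ (Equivalence.from T-not ¬a , Equivalence.from T-not ¬b))

T-allᵇ : ∀ {n} {p : Fin n → Bool} → T (allᵇ p) ⇔ (∀ i → T (p i))
T-allᵇ {p = p} = T-does (all? (λ i → T? (p i)))
  where
  T-does : ∀ {P : Set} (d : Dec P) → T (does d) ⇔ P
  T-does (yes x) = mk⇔ (λ _ → x) (λ _ → tt)
  T-does (no ¬x) = mk⇔ (λ ()) ¬x

allᵇ-counterexample : ∀ {n} {p : Fin n → Bool} → ¬ T (allᵇ p) → ∃ λ i → ¬ T (p i)
allᵇ-counterexample {n} {p} ¬all = ¬∀⟶∃¬ n (T ∘ p) (T? ∘ p) (¬all ∘ Equivalence.from T-allᵇ)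

<ᵇ-true : ∀ {m n} → m < n → (m <ᵇ n) ≡ true
<ᵇ-true m<n = Equivalence.to T-≡ (<⇒<ᵇ m<n)

<ᵇ-false : ∀ {m n} → ¬ m < n → (m <ᵇ n) ≡ false
<ᵇ-false {m} {n} m≮n = Equivalence.to T-not-≡ (Equivalence.from T-not (m≮n ∘ <ᵇ⇒< m n))

<ᵇ-flip : ∀ {x y} → x ≢ y → (x <ᵇ y) ≡ not (y <ᵇ x)
<ᵇ-flip {x} {y} x≢y with <-cmp x y
... | tri< x<y _ _ rewrite <ᵇ-true x<y | <ᵇ-false (<⇒≯ x<y) = refl
... | tri≈ _ x≡y _ = ⊥-elim (x≢y x≡y)
... | tri> _ _ y<x rewrite <ᵇ-false (<⇒≯ y<x) | <ᵇ-true y<x = refl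

<-by-eval : ∀ {m n} {_ : T (m <ᵇ n)} → m < n
<-by-eval {m} {n} {m<n} = <ᵇ⇒< m n m<n

T-search : {X : Set} (p : X → Bool) (search : List X → Bool) →
  search [] ≡ false → (∀ x L → search (x ∷ L) ≡ (p x ∨ search L)) →
  ∀ L → T (search L) ⇔ Any (T ∘ p) L
T-search p search search-[] search-∷ L = mk⇔ (to L) (from L)
  where
  to : ∀ L → T (search L) → Any (T ∘ p) L
  to []      t rewrite search-[] = ⊥-elim t
  to (x ∷ L) t rewrite search-∷ x L with Equivalence.to (T-∨ {p x}) t
  ... | inj₁ px = here px
  ... | inj₂ rest = there (to L rest)
  from : ∀ L → Any (T ∘ p) L → T (search L)
  from (x ∷ L) (here px)    rewrite search-∷ x L = Equivalence.from T-∨ (inj₁ px)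
  from (x ∷ L) (there rest) rewrite search-∷ x L = Equivalence.from (T-∨ {p x}) (inj₂ (from L rest))

𝟙 : Bool → ℤ
𝟙 true  = 1ℤ
𝟙 false = 0ℤ

𝟙-∧ : ∀ a b → 𝟙 (a ∧ b) ≡ 𝟙 a * 𝟙 b
𝟙-∧ true  b = sym (ℤ.*-identityˡ (𝟙 b))
𝟙-∧ false b = refl

sumOver : {A : Set} → List A → (A → ℤ) → ℤ
sumOver []       f = 0ℤ
sumOver (x ∷ xs) f = f x + sumOver xs f

infix 5 sumOver
syntax sumOver L (λ x → e) = ∑[ x ∈ L ] e

module _ {A : Set} where

  ∑-cong : (L : List A) {f g : A → ℤ} → (∀ x → f x ≡ g x) → ∑[ x ∈ L ] f x ≡ ∑[ x ∈ L ] g x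
  ∑-cong []      e = refl
  ∑-cong (x ∷ L) e = cong₂ _+_ (e x) (∑-cong L e)

  ∑-++ : (xs ys : List A) (f : A → ℤ) → ∑[ x ∈ xs ++ ys ] f x ≡ (∑[ x ∈ xs ] f x) + (∑[ x ∈ ys ] f x)
  ∑-++ []       ys f = sym (ℤ.+-identityˡ _)
  ∑-++ (x ∷ xs) ys f = trans (cong (f x +_) (∑-++ xs ys f)) (sym (ℤ.+-assoc (f x) _ _))

  ∑-zero : (L : List A) → ∑[ x ∈ L ] 0ℤ ≡ 0ℤ
  ∑-zero []      = refl
  ∑-zero (x ∷ L) = trans (ℤ.+-identityˡ _) (∑-zero L)

  ∑-distrib-+ : (L : List A) (f g : A → ℤ) →
    ∑[ x ∈ L ] (f x + g x) ≡ (∑[ x ∈ L ] f x) + (∑[ x ∈ L ] g x)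
  ∑-distrib-+ []      f g = refl
  ∑-distrib-+ (x ∷ L) f g =
    trans (cong (f x + g x +_) (∑-distrib-+ L f g)) (interchange (f x) (g x) _ _)
    where
    interchange : ∀ a b c d → a + b + (c + d) ≡ a + c + (b + d)
    interchange = solve-∀

  ∑-distribˡ-* : (L : List A) (c : ℤ) (f : A → ℤ) → ∑[ x ∈ L ] c * f x ≡ c * (∑[ x ∈ L ] f x)
  ∑-distribˡ-* []      c f = sym (ℤ.*-zeroʳ c)
  ∑-distribˡ-* (x ∷ L) c f =
    trans (cong (c * f x +_) (∑-distribˡ-* L c f)) (sym (ℤ.*-distribˡ-+ c (f x) _))

  ∑-distribʳ-* : (L : List A) (c : ℤ) (f : A → ℤ) → ∑[ x ∈ L ] f x * c ≡ (∑[ x ∈ L ] f x) * c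
  ∑-distribʳ-* L c f =
    trans (∑-cong L (λ x → ℤ.*-comm (f x) c)) (trans (∑-distribˡ-* L c f) (ℤ.*-comm c _))

  ∑-filter : (L : List A) (p : A → Bool) (f : A → ℤ) →
    ∑[ x ∈ filter (T? ∘ p) L ] f x ≡ ∑[ x ∈ L ] 𝟙 (p x) * f x
  ∑-filter []      p f = refl
  ∑-filter (x ∷ L) p f with p x
  ... | true  = cong₂ _+_ (sym (ℤ.*-identityˡ (f x))) (∑-filter L p f)
  ... | false = trans (∑-filter L p f) (sym (ℤ.+-identityˡ _))

module _ {A B : Set} where

  ∑-map : (L : List A) (h : A → B) (f : B → ℤ) → ∑[ y ∈ map h L ] f y ≡ ∑[ x ∈ L ] f (h x)
  ∑-map []      h f = refl
  ∑-map (x ∷ L) h f = cong (f (h x) +_) (∑-map L h f)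

  ∑-concatMap : (L : List A) (h : A → List B) (f : B → ℤ) →
    ∑[ y ∈ concatMap h L ] f y ≡ ∑[ x ∈ L ] ∑[ y ∈ h x ] f y
  ∑-concatMap []      h f = refl
  ∑-concatMap (x ∷ L) h f =
    trans (∑-++ (h x) (concatMap h L) f) (cong ((∑[ y ∈ h x ] f y) +_) (∑-concatMap L h f))

  ∑-comm : (LA : List A) (LB : List B) (f : A → B → ℤ) →
    ∑[ x ∈ LA ] ∑[ y ∈ LB ] f x y ≡ ∑[ y ∈ LB ] ∑[ x ∈ LA ] f x y
  ∑-comm []       LB f = sym (∑-zero LB)
  ∑-comm (x ∷ LA) LB f =
    trans (cong ((∑[ y ∈ LB ] f x y) +_) (∑-comm LA LB f)) (sym (∑-distrib-+ LB (f x) _))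

∑-tabulate-zero : ∀ {A : Set} {m} {h : Fin m → A} (f : A → ℤ) → (∀ i → f (h i) ≡ 0ℤ) → ∑[ x ∈ tabulate h ] f x ≡ 0ℤ
∑-tabulate-zero {m = zero}  f zeros = refl
∑-tabulate-zero {m = suc m} f zeros = trans (cong₂ _+_ (zeros zero) (∑-tabulate-zero f (zeros ∘ suc))) (ℤ.+-identityˡ 0ℤ)

Any-from-∑𝟙 : {A : Set} (L : List A) (p : A → Bool) → ∑[ x ∈ L ] 𝟙 (p x) ≡ 1ℤ → Any (T ∘ p) L
Any-from-∑𝟙 (x ∷ L) p sum≡1 with p x in px
... | true  = here (subst T (sym px) tt)
... | false = there (Any-from-∑𝟙 L p (trans (sym (ℤ.+-identityˡ _)) sum≡1))

record Enumerates {A : Set} (L : List A) (_≈?_ : A → A → Bool) : Set where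
  constructor enumerates
  field
    occurs-once : ∀ y → ∑[ x ∈ L ] 𝟙 (x ≈? y) ≡ 1ℤ

Respects : {A : Set} → (A → A → Bool) → (A → ℤ) → Set
Respects _≈?_ g = ∀ {x y} → T (x ≈? y) → g x ≡ g y

module _ {A : Set} {L : List A} {_≈?_ : A → A → Bool} (enum : Enumerates L _≈?_) where

  ∑-count : ∀ y c → ∑[ x ∈ L ] 𝟙 (x ≈? y) * c ≡ c
  ∑-count y c = begin
    ∑[ x ∈ L ] 𝟙 (x ≈? y) * c      ≡⟨ ∑-distribʳ-* L c (λ x → 𝟙 (x ≈? y)) ⟩
    (∑[ x ∈ L ] 𝟙 (x ≈? y)) * c    ≡⟨ cong (_* c) (Enumerates.occurs-once enum y) ⟩
    1ℤ * c                         ≡⟨ ℤ.*-identityˡ c ⟩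
    c                              ∎

  ∑-sift : (g : A → ℤ) → Respects _≈?_ g → ∀ y → ∑[ x ∈ L ] 𝟙 (x ≈? y) * g x ≡ g y
  ∑-sift g resp y = trans (∑-cong L pointwise) (∑-count y (g y))
    where
    pointwise : ∀ x → 𝟙 (x ≈? y) * g x ≡ 𝟙 (x ≈? y) * g y
    pointwise x with x ≈? y in eq
    ... | true  = cong (1ℤ *_) (resp (subst T (sym eq) tt))
    ... | false = refl

  ∑-involution : (φ : A → A) → (∀ x y → (x ≈? φ y) ≡ (y ≈? φ x)) →
    (g : A → ℤ) → Respects _≈?_ g → ∑[ x ∈ L ] g (φ x) ≡ ∑[ x ∈ L ] g x
  ∑-involution φ flip g resp = begin
    ∑[ x ∈ L ] g (φ x)
      ≡⟨ ∑-cong L (λ x → sym (∑-sift g resp (φ x))) ⟩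
    ∑[ x ∈ L ] (∑[ y ∈ L ] 𝟙 (y ≈? φ x) * g y)
      ≡⟨ ∑-comm L L _ ⟩
    ∑[ y ∈ L ] (∑[ x ∈ L ] 𝟙 (y ≈? φ x) * g y)
      ≡⟨ ∑-cong L (λ y → ∑-cong L (λ x → cong (λ b → 𝟙 b * g y) (flip y x))) ⟩
    ∑[ y ∈ L ] (∑[ x ∈ L ] 𝟙 (x ≈? φ y) * g y)
      ≡⟨ ∑-cong L (λ y → ∑-count (φ y) (g y)) ⟩
    ∑[ y ∈ L ] g y ∎

module _ {X Y Z : Set} {LX : List X} {LY : List Y} {LZ : List Z}
         {_≈X?_ : X → X → Bool} {_≈Y?_ : Y → Y → Bool} {_≈Z?_ : Z → Z → Bool}
         (enumX : Enumerates LX _≈X?_) (enumY : Enumerates LY _≈Y?_) (enumZ : Enumerates LZ _≈Z?_)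
         (q : X → Bool) (a : Y → Z → Bool) (e : Y → Z → X) (r₁ : X → Y) (r₂ : X → Z)
         (graph : ∀ x y z → (a y z ∧ x ≈X? e y z) ≡ (q x ∧ (y ≈Y? r₁ x ∧ z ≈Z? r₂ x))) where

  ∑-reindex-pairs : (g : X → ℤ) → Respects _≈X?_ g →
    ∑[ y ∈ LY ] (∑[ z ∈ LZ ] 𝟙 (a y z) * g (e y z)) ≡ ∑[ x ∈ LX ] 𝟙 (q x) * g x
  ∑-reindex-pairs g resp = begin
    ∑[ y ∈ LY ] (∑[ z ∈ LZ ] 𝟙 (a y z) * g (e y z))
      ≡⟨ ∑-cong LY (λ y → ∑-cong LZ (λ z → sifted y z)) ⟩
    ∑[ y ∈ LY ] (∑[ z ∈ LZ ] (∑[ x ∈ LX ] χ x y z * g x))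
      ≡⟨ ∑-cong LY (λ y → ∑-comm LZ LX _) ⟩
    ∑[ y ∈ LY ] (∑[ x ∈ LX ] (∑[ z ∈ LZ ] χ x y z * g x))
      ≡⟨ ∑-comm LY LX _ ⟩
    ∑[ x ∈ LX ] (∑[ y ∈ LY ] (∑[ z ∈ LZ ] χ x y z * g x))
      ≡⟨ ∑-cong LX counted ⟩
    ∑[ x ∈ LX ] 𝟙 (q x) * g x ∎
    where
    χ : X → Y → Z → ℤ
    χ x y z = 𝟙 (q x ∧ (y ≈Y? r₁ x ∧ z ≈Z? r₂ x))

    sifted : ∀ y z → 𝟙 (a y z) * g (e y z) ≡ ∑[ x ∈ LX ] χ x y z * g x
    sifted y z = begin
      𝟙 (a y z) * g (e y z)
        ≡⟨ cong (𝟙 (a y z) *_) (∑-sift enumX g resp (e y z)) ⟨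
      𝟙 (a y z) * (∑[ x ∈ LX ] 𝟙 (x ≈X? e y z) * g x)
        ≡⟨ ∑-distribˡ-* LX (𝟙 (a y z)) _ ⟨
      ∑[ x ∈ LX ] 𝟙 (a y z) * (𝟙 (x ≈X? e y z) * g x)
        ≡⟨ ∑-cong LX (λ x → sym (ℤ.*-assoc (𝟙 (a y z)) _ (g x))) ⟩
      ∑[ x ∈ LX ] 𝟙 (a y z) * 𝟙 (x ≈X? e y z) * g x
        ≡⟨ ∑-cong LX (λ x → cong (_* g x) (trans (sym (𝟙-∧ (a y z) _)) (cong 𝟙 (graph x y z)))) ⟩
      ∑[ x ∈ LX ] χ x y z * g x ∎

    counted : ∀ x → ∑[ y ∈ LY ] (∑[ z ∈ LZ ] χ x y z * g x) ≡ 𝟙 (q x) * g x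
    counted x = begin
      ∑[ y ∈ LY ] (∑[ z ∈ LZ ] χ x y z * g x)
        ≡⟨ ∑-cong LY (λ y → ∑-cong LZ (λ z → split y z)) ⟩
      ∑[ y ∈ LY ] (∑[ z ∈ LZ ] 𝟙 (z ≈Z? r₂ x) * (𝟙 (y ≈Y? r₁ x) * (𝟙 (q x) * g x)))
        ≡⟨ ∑-cong LY (λ y → ∑-count enumZ (r₂ x) _) ⟩
      ∑[ y ∈ LY ] 𝟙 (y ≈Y? r₁ x) * (𝟙 (q x) * g x)
        ≡⟨ ∑-count enumY (r₁ x) _ ⟩
      𝟙 (q x) * g x ∎
      where
      split : ∀ y z → χ x y z * g x ≡ 𝟙 (z ≈Z? r₂ x) * (𝟙 (y ≈Y? r₁ x) * (𝟙 (q x) * g x))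
      split y z rewrite 𝟙-∧ (q x) (y ≈Y? r₁ x ∧ z ≈Z? r₂ x) | 𝟙-∧ (y ≈Y? r₁ x) (z ≈Z? r₂ x) =
        reassoc (𝟙 (q x)) (𝟙 (y ≈Y? r₁ x)) (𝟙 (z ≈Z? r₂ x)) (g x)
        where
        reassoc : ∀ u v w h → u * (v * w) * h ≡ w * (v * (u * h))
        reassoc = solve-∀

Enumerates-Any : {A : Set} {L : List A} {_≈?_ : A → A → Bool} →
  Enumerates L _≈?_ → ∀ y → Any (λ x → T (x ≈? y)) L
Enumerates-Any {L = L} {_≈?_} enum y = Any-from-∑𝟙 L (_≈? y) (Enumerates.occurs-once enum y)

_≟ᵇ_ : ∀ {m} → Fin m → Fin m → Bool
i ≟ᵇ j = does (i ≟ j)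

T-≟ᵇ : ∀ {m} {i j : Fin m} → T (i ≟ᵇ j) ⇔ i ≡ j
T-≟ᵇ {i = i} {j} with i ≟ j
... | yes i≡j = mk⇔ (λ _ → i≡j) (λ _ → tt)
... | no  i≢j = mk⇔ (λ ()) i≢j

allFin-enumerates : ∀ m → Enumerates (allFin m) _≟ᵇ_
allFin-enumerates m = enumerates (count m)
  where
  count : ∀ m (y : Fin m) → ∑[ x ∈ allFin m ] 𝟙 (x ≟ᵇ y) ≡ 1ℤ
  count (suc m) y = begin
    𝟙 (zero ≟ᵇ y) + (∑[ x ∈ tabulate suc ] 𝟙 (x ≟ᵇ y))
      ≡⟨ cong (λ L → 𝟙 (zero ≟ᵇ y) + (∑[ x ∈ L ] 𝟙 (x ≟ᵇ y))) (map-tabulate (λ i → i) suc) ⟨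
    𝟙 (zero ≟ᵇ y) + (∑[ x ∈ map suc (allFin m) ] 𝟙 (x ≟ᵇ y))
      ≡⟨ cong (𝟙 (zero ≟ᵇ y) +_) (∑-map (allFin m) suc _) ⟩
    𝟙 (zero ≟ᵇ y) + (∑[ x ∈ allFin m ] 𝟙 (suc x ≟ᵇ y))
      ≡⟨ split y ⟩
    1ℤ ∎
    where
    split : ∀ y → 𝟙 (zero ≟ᵇ y) + (∑[ x ∈ allFin m ] 𝟙 (suc x ≟ᵇ y)) ≡ 1ℤ
    split zero    = cong (1ℤ +_) (∑-zero (allFin m))
    split (suc y) = trans (ℤ.+-identityˡ _) (count m y)

_≗ᵇ_ : ∀ {n m} → (Fin n → Fin m) → (Fin n → Fin m) → Bool
_≗ᵇ_ {zero}  f g = true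
_≗ᵇ_ {suc n} f g = (f zero ≟ᵇ g zero) ∧ ((f ∘ suc) ≗ᵇ (g ∘ suc))

T-≗ᵇ : ∀ {n m} {f g : Fin n → Fin m} → T (f ≗ᵇ g) ⇔ f ≗ g
T-≗ᵇ {zero}  = mk⇔ (λ _ ()) (λ _ → tt)
T-≗ᵇ {suc n} {m} {f} {g} = mk⇔ to from
  where
  to : T (f ≗ᵇ g) → f ≗ g
  to t zero    = Equivalence.to T-≟ᵇ (proj₁ (Equivalence.to T-∧ t))
  to t (suc i) = Equivalence.to (T-≗ᵇ {n}) (proj₂ (Equivalence.to (T-∧ {f zero ≟ᵇ g zero}) t)) i
  from : f ≗ g → T (f ≗ᵇ g)
  from f≗g = Equivalence.from T-∧ (Equivalence.from T-≟ᵇ (f≗g zero) , Equivalence.from (T-≗ᵇ {n}) (f≗g ∘ suc))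

allFuns-enumerates : ∀ n m → Enumerates (allFuns n m) _≗ᵇ_
allFuns-enumerates n m = enumerates (count n)
  where
  count : ∀ n (h : Fin n → Fin m) → ∑[ f ∈ allFuns n m ] 𝟙 (f ≗ᵇ h) ≡ 1ℤ
  count zero    h = refl
  count (suc n) h = begin
    ∑[ f ∈ allFuns (suc n) m ] 𝟙 (f ≗ᵇ h)
      ≡⟨ ∑-concatMap (allFuns n m) _ _ ⟩
    ∑[ f ∈ allFuns n m ] (∑[ g ∈ map _ (allFin m) ] 𝟙 (g ≗ᵇ h))
      ≡⟨ ∑-cong (allFuns n m) (λ f → ∑-map (allFin m) _ _) ⟩
    ∑[ f ∈ allFuns n m ] (∑[ x ∈ allFin m ] 𝟙 ((x ≟ᵇ h zero) ∧ (f ≗ᵇ (h ∘ suc))))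
      ≡⟨ ∑-cong (allFuns n m) (λ f → ∑-cong (allFin m) (λ x → 𝟙-∧ (x ≟ᵇ h zero) _)) ⟩
    ∑[ f ∈ allFuns n m ] (∑[ x ∈ allFin m ] 𝟙 (x ≟ᵇ h zero) * 𝟙 (f ≗ᵇ (h ∘ suc)))
      ≡⟨ ∑-cong (allFuns n m) (λ f → ∑-count (allFin-enumerates m) (h zero) _) ⟩
    ∑[ f ∈ allFuns n m ] 𝟙 (f ≗ᵇ (h ∘ suc))
      ≡⟨ count n (h ∘ suc) ⟩
    1ℤ ∎

<ᶠ⇒≢ : ∀ {n} {i j : Fin n} → i <ᶠ j → i ≢ j
<ᶠ⇒≢ i<j i≡j = <-irrefl (cong toℕ i≡j) i<j

punchIn-mono-< : ∀ {n} (p : Fin (suc n)) {i j : Fin n} → i <ᶠ j → punchIn p i <ᶠ punchIn p j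
punchIn-mono-< p {i} {j} i<j = ≰⇒> (<⇒≱ i<j ∘ punchIn-cancel-≤ p j i)

punchOut-mono-< : ∀ {n} {p i j : Fin (suc n)} (p≢i : p ≢ i) (p≢j : p ≢ j) → i <ᶠ j → punchOut p≢i <ᶠ punchOut p≢j
punchOut-mono-< p≢i p≢j i<j = ≰⇒> (<⇒≱ i<j ∘ punchOut-cancel-≤ p≢j p≢i)

toℕ-punchIn-< : ∀ {n} (p : Fin (suc n)) {j : Fin n} → toℕ j < toℕ p → toℕ (punchIn p j) ≡ toℕ j
toℕ-punchIn-< (suc p) {zero}  _         = refl
toℕ-punchIn-< (suc p) {suc j} (s≤s j<p) = cong suc (toℕ-punchIn-< p j<p)

toℕ-punchOut-≤ : ∀ {n} {i j : Fin (suc n)} (i≢j : i ≢ j) → toℕ (punchOut i≢j) ≤ toℕ j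
toℕ-punchOut-≤ {_}     {zero}  {zero}  0≢0 = ⊥-elim (0≢0 refl)
toℕ-punchOut-≤ {_}     {zero}  {suc j} _   = n≤1+n (toℕ j)
toℕ-punchOut-≤ {suc n} {suc i} {zero}  _   = z≤n
toℕ-punchOut-≤ {suc n} {suc i} {suc j} i≢j = s≤s (toℕ-punchOut-≤ (i≢j ∘ cong suc))

punchIn-<ᵇ : ∀ {n} (p : Fin (suc n)) (i j : Fin n) → (toℕ (punchIn p i) <ᵇ toℕ (punchIn p j)) ≡ (toℕ i <ᵇ toℕ j)
punchIn-<ᵇ p i j = T-injective (mk⇔
  (λ lt → <⇒<ᵇ (≰⇒> (<⇒≱ (<ᵇ⇒< _ _ lt) ∘ punchIn-mono-≤ p j i)))
  (λ lt → <⇒<ᵇ (punchIn-mono-< p (<ᵇ⇒< _ _ lt))))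

pinch-inject₁ : ∀ {n} (y : Fin (suc n)) → pinch (fromℕ n) (inject₁ y) ≡ y
pinch-inject₁ {zero}  zero    = refl
pinch-inject₁ {suc n} zero    = refl
pinch-inject₁ {suc n} (suc y) = cong suc (pinch-inject₁ y)

inject₁-pinch : ∀ {n} (x : Fin (suc (suc n))) → x ≢ fromℕ (suc n) → inject₁ (pinch (fromℕ n) x) ≡ x
inject₁-pinch         zero          _   = refl
inject₁-pinch {zero}  (suc zero)    x≢1 = ⊥-elim (x≢1 refl)
inject₁-pinch {suc n} (suc x)       x≢  = cong suc (inject₁-pinch x (x≢ ∘ cong suc))

opposite-<ᵇ : ∀ {n} (x y : Fin n) → (toℕ (opposite x) <ᵇ toℕ (opposite y)) ≡ (toℕ y <ᵇ toℕ x)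
opposite-<ᵇ {n} x y rewrite opposite-prop x | opposite-prop y = T-injective (mk⇔
  (λ lt → <⇒<ᵇ (≰⇒> λ x≤y → <⇒≱ (<ᵇ⇒< _ _ lt) (∸-monoʳ-≤ n (s≤s x≤y))))
  (λ lt → <⇒<ᵇ (∸-monoʳ-< (s≤s (<ᵇ⇒< _ _ lt)) (toℕ<n x))))

opposite-mono-< : ∀ {n} {i j : Fin n} → i <ᶠ j → opposite j <ᶠ opposite i
opposite-mono-< {i = i} {j} i<j = <ᵇ⇒< _ _ (subst T (sym (opposite-<ᵇ j i)) (<⇒<ᵇ i<j))

Occurrence : ∀ {k n} → Word k → Word n → (Fin k → Fin n) → Set
Occurrence σ w ι = ∀ {s t} → s <ᶠ t → ι s <ᶠ ι t × (w (ι t) <ᵇ w (ι s)) ≡ (σ t <ᵇ σ s)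

-- occursAtᵇ compares the two orders with a Boolean equality local to Defs, which computes only after
-- both comparisons are abstracted; so completeness is shown through a failing entry.
T-occursAtᵇ : ∀ {k n} (σ : Word k) (w : Word n) ι → T (occursAtᵇ σ w ι) ⇔ Occurrence σ w ι
T-occursAtᵇ σ w ι = mk⇔ sound complete
  where
  sound : T (occursAtᵇ σ w ι) → Occurrence σ w ι
  sound t {s} {u} s<u
    with toℕ s <ᵇ toℕ u | <⇒<ᵇ s<u | Equivalence.to T-allᵇ (Equivalence.to T-allᵇ t s) u
  ... | true | _ | entry
    with toℕ (ι s) <ᵇ toℕ (ι u) in ιs<ιu | w (ι u) <ᵇ w (ι s) | σ u <ᵇ σ s | entry
  ... | true | true  | true  | _ = <ᵇ⇒< _ _ (subst T (sym ιs<ιu) tt) , refl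
  ... | true | false | false | _ = <ᵇ⇒< _ _ (subst T (sym ιs<ιu) tt) , refl

  complete : Occurrence σ w ι → T (occursAtᵇ σ w ι)
  complete occ with occursAtᵇ σ w ι in ¬occurs
  ... | true  = tt
  ... | false with allᵇ-counterexample (λ t → subst T ¬occurs t)
  ... | s , ¬row with allᵇ-counterexample ¬row
  ... | u , ¬entry
    with toℕ s <ᵇ toℕ u in s<u | toℕ (ι s) <ᵇ toℕ (ι u) in ιs<ιu
       | w (ι u) <ᵇ w (ι s) in wu<ws | σ u <ᵇ σ s in σu<σs | ¬entry
  ... | false | _     | _     | _     | ¬e = ¬e tt
  ... | true  | false | _     | _     | _  =
    subst T ιs<ιu (<⇒<ᵇ (proj₁ (occ (<ᵇ⇒< _ _ (subst T (sym s<u) tt)))))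
  ... | true  | true  | true  | true  | ¬e = ¬e tt
  ... | true  | true  | false | false | ¬e = ¬e tt
  ... | true  | true  | true  | false | _  =
    true≢false (trans (sym wu<ws) (trans (proj₂ (occ (<ᵇ⇒< _ _ (subst T (sym s<u) tt)))) σu<σs))
  ... | true  | true  | false | true  | _  =
    true≢false (trans (sym σu<σs) (trans (sym (proj₂ (occ (<ᵇ⇒< _ _ (subst T (sym s<u) tt))))) wu<ws))

-- containsᵇ scans allFuns with a local function; abstracting over the list exposes that function,
-- which T-search then pins down by its two defining equations.
T-containsᵇ-search : ∀ {k n} (σ : Word k) (w : Word n) →
  T (containsᵇ σ w) ⇔ Any (T ∘ occursAtᵇ σ w) (allFuns k n)
T-containsᵇ-search {k} {n} σ w with allFuns k n | T-search (occursAtᵇ σ w) _ refl (λ _ _ → refl)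
... | L | search = search L

Occurrence-cong : ∀ {k n} {σ σ′ : Word k} {w w′ : Word n} {ι ι′ : Fin k → Fin n} →
  σ ≗ σ′ → w ≗ w′ → ι ≗ ι′ → Occurrence σ w ι → Occurrence σ′ w′ ι′
Occurrence-cong {σ = σ} {σ′} {w} {w′} {ι} {ι′} σ≗ w≗ ι≗ occ {s} {t} s<t
  rewrite sym (σ≗ s) | sym (σ≗ t) | sym (ι≗ s) | sym (ι≗ t) | sym (w≗ (ι s)) | sym (w≗ (ι t)) = occ s<t

T-containsᵇ : ∀ {k n} (σ : Word k) (w : Word n) → T (containsᵇ σ w) ⇔ ∃ (Occurrence σ w)
T-containsᵇ {k} {n} σ w = mk⇔ to from
  where
  to : T (containsᵇ σ w) → ∃ (Occurrence σ w)
  to t with Any.satisfied (Equivalence.to (T-containsᵇ-search σ w) t)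
  ... | ι , occurs = ι , Equivalence.to (T-occursAtᵇ σ w ι) occurs
  from : ∃ (Occurrence σ w) → T (containsᵇ σ w)
  from (ι , occ) = Equivalence.from (T-containsᵇ-search σ w)
    (Any.map (λ {ι′} ι′≈ι → Equivalence.from (T-occursAtᵇ σ w ι′)
                (Occurrence-cong {σ = σ} {w = w} (λ _ → refl) (λ _ → refl)
                                 (λ s → sym (Equivalence.to T-≗ᵇ ι′≈ι s)) occ))
             (Enumerates-Any (allFuns-enumerates k n) ι))

containsᵇ-cong : ∀ {k n} {σ σ′ : Word k} {w w′ : Word n} →
  σ ≗ σ′ → w ≗ w′ → containsᵇ σ w ≡ containsᵇ σ′ w′
containsᵇ-cong {σ = σ} {σ′} {w} {w′} σ≗ w≗ = T-injective (mk⇔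
  (λ t → let ι , occ = Equivalence.to (T-containsᵇ σ w) t in
         Equivalence.from (T-containsᵇ σ′ w′) (ι , Occurrence-cong σ≗ w≗ (λ _ → refl) occ))
  (λ t → let ι , occ = Equivalence.to (T-containsᵇ σ′ w′) t in
         Equivalence.from (T-containsᵇ σ w) (ι , Occurrence-cong (sym ∘ σ≗) (sym ∘ w≗) (λ _ → refl) occ)))

IsPerm : ∀ {n} → (Fin n → Fin n) → Set
IsPerm π = Injective _≡_ _≡_ π

T-isPermᵇ : ∀ {n} (π : Fin n → Fin n) → T (isPermᵇ π) ⇔ IsPerm π
T-isPermᵇ π = mk⇔ to from
  where
  to : T (isPermᵇ π) → IsPerm π
  to t {i} {j} πi≡πj with Equivalence.to T-∨ (Equivalence.to T-allᵇ (Equivalence.to T-allᵇ t i) j)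
  ... | inj₁ i≡j   = toℕ-injective (≡ᵇ⇒≡ _ _ i≡j)
  ... | inj₂ πi≢πj = ⊥-elim (Equivalence.to T-not πi≢πj (≡⇒≡ᵇ _ _ (cong toℕ πi≡πj)))
  from : IsPerm π → T (isPermᵇ π)
  from inj = Equivalence.from T-allᵇ λ i → Equivalence.from T-allᵇ λ j →
    Equivalence.from T-∨ (entry i j)
    where
    entry : ∀ i j → T (toℕ i ≡ᵇ toℕ j) ⊎ T (not (toℕ (π i) ≡ᵇ toℕ (π j)))
    entry i j with T? (toℕ i ≡ᵇ toℕ j)
    ... | yes i≡j = inj₁ i≡j
    ... | no  i≢j = inj₂ (Equivalence.from T-not λ πi≡πj →
                      i≢j (≡⇒≡ᵇ _ _ (cong toℕ (inj (toℕ-injective (≡ᵇ⇒≡ _ _ πi≡πj))))))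

IsPerm-cong : ∀ {n} {π π′ : Fin n → Fin n} → π ≗ π′ → IsPerm π → IsPerm π′
IsPerm-cong π≗π′ inj e = inj (trans (π≗π′ _) (trans e (sym (π≗π′ _))))

isPermᵇ-true : ∀ {n} {π : Fin n → Fin n} → IsPerm π → isPermᵇ π ≡ true
isPermᵇ-true {π = π} inj = Equivalence.to T-≡ (Equivalence.from (T-isPermᵇ π) inj)

isPermᵇ-cong : ∀ {n} {π π′ : Fin n → Fin n} → π ≗ π′ → isPermᵇ π ≡ isPermᵇ π′
isPermᵇ-cong {π = π} {π′} π≗π′ = T-injective (mk⇔
  (Equivalence.from (T-isPermᵇ π′) ∘ IsPerm-cong π≗π′ ∘ Equivalence.to (T-isPermᵇ π))
  (Equivalence.from (T-isPermᵇ π) ∘ IsPerm-cong (sym ∘ π≗π′) ∘ Equivalence.to (T-isPermᵇ π′)))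

opposite-injective : ∀ {n} → IsPerm (opposite {n})
opposite-injective {x = i} {j} eq =
  trans (sym (opposite-involutive i)) (trans (cong opposite eq) (opposite-involutive j))

word-≢ : ∀ {n} {π : Fin n → Fin n} → IsPerm π → ∀ {i j} → i ≢ j → word π i ≢ word π j
word-≢ inj i≢j = i≢j ∘ inj ∘ toℕ-injective

word-compare : ∀ {n} {π : Fin n → Fin n} → IsPerm π → ∀ {i j} → i ≢ j → word π i < word π j ⊎ word π j < word π i
word-compare {π = π} inj {i} {j} i≢j with <-cmp (word π i) (word π j)
... | tri< lt _ _ = inj₁ lt
... | tri≈ _ eq _ = ⊥-elim (word-≢ inj i≢j eq)
... | tri> _ _ gt = inj₂ gt

-- Signs and inversions

*-annihilates : ∀ c {x} → x ≡ 0ℤ → c * x ≡ 0ℤ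
*-annihilates c refl = ℤ.*-zeroʳ c

sgn : ℕ → ℤ
sgn k = if even? k then 1ℤ else ℤ.-1ℤ

sgn-suc : ∀ k → sgn (suc k) ≡ ℤ.- sgn k
sgn-suc k with even? k
... | true  = refl
... | false = refl

sgn-suc-suc : ∀ m → sgn (suc (suc m)) ≡ sgn m
sgn-suc-suc m = trans (sgn-suc (suc m)) (trans (cong ℤ.-_ (sgn-suc m)) (ℤ.neg-involutive (sgn m)))

sgn-+ : ∀ a b → sgn (a ℕ.+ b) ≡ sgn a * sgn b
sgn-+ zero    b = sym (ℤ.*-identityˡ (sgn b))
sgn-+ (suc a) b = begin
  sgn (suc (a ℕ.+ b))        ≡⟨ sgn-suc (a ℕ.+ b) ⟩
  ℤ.- sgn (a ℕ.+ b)          ≡⟨ cong ℤ.-_ (sgn-+ a b) ⟩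
  ℤ.- (sgn a * sgn b)        ≡⟨ ℤ.neg-distribˡ-* (sgn a) (sgn b) ⟩
  ℤ.- sgn a * sgn b          ≡⟨ cong (_* sgn b) (sgn-suc a) ⟨
  sgn (suc a) * sgn b        ∎

sgn-cancel : ∀ a b c → a ℕ.+ b ≡ c → sgn a ≡ sgn c * sgn b
sgn-cancel a b c a+b≡c = begin
  sgn a                       ≡⟨ ℤ.*-identityʳ (sgn a) ⟨
  sgn a * 1ℤ                  ≡⟨ cong (sgn a *_) (sgn-square b) ⟨
  sgn a * (sgn b * sgn b)     ≡⟨ ℤ.*-assoc (sgn a) (sgn b) (sgn b) ⟨
  sgn a * sgn b * sgn b       ≡⟨ cong (_* sgn b) (trans (sym (cong sgn a+b≡c)) (sgn-+ a b)) ⟨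
  sgn c * sgn b               ∎
  where
  sgn-square : ∀ b → sgn b * sgn b ≡ 1ℤ
  sgn-square b with even? b
  ... | true  = refl
  ... | false = refl

module ℕ∑ = CommutativeMonoidSum ℕ.+-0-commutativeMonoid
open ℕ∑ using (sum-syntax)

∑-allFin : ∀ n (f : Fin n → ℕ) → ListAction.sum (map f (allFin n)) ≡ ∑[ i < n ] f i
∑-allFin n f = go n (λ i → i)
  where
  go : ∀ m (h : Fin m → Fin n) → ListAction.sum (map f (tabulate h)) ≡ ∑[ i < m ] f (h i)
  go zero    h = refl
  go (suc m) h = cong (f (h zero) ℕ.+_) (go m (h ∘ suc))

inverted : ∀ {n} → (Fin n → Fin n) → Fin n → Fin n → ℕ
inverted π i j = if (toℕ i <ᵇ toℕ j) ∧ (toℕ (π j) <ᵇ toℕ (π i)) then 1 else 0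

inv-∑ : ∀ {n} (π : Fin n → Fin n) → inv π ≡ ∑[ i < n ] ∑[ j < n ] inverted π i j
inv-∑ {n} π = begin
  ListAction.sum (map (λ i → ListAction.sum (map (inverted π i) (allFin n))) (allFin n))
    ≡⟨ ∑-allFin n _ ⟩
  ∑[ i < n ] ListAction.sum (map (inverted π i) (allFin n))
    ≡⟨ ℕ∑.sum-cong-≗ (λ i → ∑-allFin n (inverted π i)) ⟩
  ∑[ i < n ] ∑[ j < n ] inverted π i j ∎

inv-cong : ∀ {n} {π π′ : Fin n → Fin n} → π ≗ π′ → inv π ≡ inv π′
inv-cong {n} {π} {π′} π≗π′ = begin
  inv π                                  ≡⟨ inv-∑ π ⟩
  ∑[ i < n ] ∑[ j < n ] inverted π i j   ≡⟨ ℕ∑.sum-cong-≗ (λ i → ℕ∑.sum-cong-≗ (λ j → same i j)) ⟩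
  ∑[ i < n ] ∑[ j < n ] inverted π′ i j  ≡⟨ inv-∑ π′ ⟨
  inv π′                                 ∎
  where
  same : ∀ i j → inverted π i j ≡ inverted π′ i j
  same i j rewrite π≗π′ i | π≗π′ j = refl

pairs : ℕ → ℕ
pairs n = ∑[ i < n ] ∑[ j < n ] (if toℕ {n} i <ᵇ toℕ j then 1 else 0)

inv-complement : ∀ {n} (π : Fin n → Fin n) → IsPerm π → inv (opposite ∘ π) ℕ.+ inv π ≡ pairs n
inv-complement {n} π inj = begin
  inv (opposite ∘ π) ℕ.+ inv π
    ≡⟨ cong₂ ℕ._+_ (inv-∑ (opposite ∘ π)) (inv-∑ π) ⟩
  (∑[ i < n ] ∑[ j < n ] inverted (opposite ∘ π) i j) ℕ.+ (∑[ i < n ] ∑[ j < n ] inverted π i j)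
    ≡⟨ ℕ∑.∑-distrib-+ (λ i → ∑[ j < n ] inverted (opposite ∘ π) i j) (λ i → ∑[ j < n ] inverted π i j) ⟨
  ∑[ i < n ] ((∑[ j < n ] inverted (opposite ∘ π) i j) ℕ.+ (∑[ j < n ] inverted π i j))
    ≡⟨ ℕ∑.sum-cong-≗ (λ i → sym (ℕ∑.∑-distrib-+ (inverted (opposite ∘ π) i) (inverted π i))) ⟩
  ∑[ i < n ] ∑[ j < n ] (inverted (opposite ∘ π) i j ℕ.+ inverted π i j)
    ≡⟨ ℕ∑.sum-cong-≗ (λ i → ℕ∑.sum-cong-≗ (pair i)) ⟩
  pairs n ∎
  where
  pair : ∀ i j → inverted (opposite ∘ π) i j ℕ.+ inverted π i j ≡ (if toℕ i <ᵇ toℕ j then 1 else 0)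
  pair i j rewrite opposite-<ᵇ (π j) (π i) with toℕ i <ᵇ toℕ j in i<j
  ... | false = refl
  ... | true with toℕ (π i) <ᵇ toℕ (π j) in πi<πj | toℕ (π j) <ᵇ toℕ (π i) in πj<πi
  ...   | true  | false = refl
  ...   | false | true  = refl
  ...   | true  | true  =
    ⊥-elim (<⇒≯ (<ᵇ⇒< (toℕ (π i)) _ (subst T (sym πi<πj) tt)) (<ᵇ⇒< (toℕ (π j)) _ (subst T (sym πj<πi) tt)))
  ...   | false | false with word-compare inj (<ᶠ⇒≢ (<ᵇ⇒< (toℕ i) (toℕ j) (subst T (sym i<j) tt)))
  ...     | inj₁ lt = ⊥-elim (subst T πi<πj (<⇒<ᵇ lt))
  ...     | inj₂ gt = ⊥-elim (subst T πj<πi (<⇒<ᵇ gt))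

inv-reverse : ∀ {n} (π : Fin n → Fin n) → inv (π ∘ opposite) ≡ inv (opposite ∘ π)
inv-reverse {n} π = begin
  inv (π ∘ opposite)
    ≡⟨ inv-∑ (π ∘ opposite) ⟩
  ∑[ i < n ] ∑[ j < n ] inverted (π ∘ opposite) i j
    ≡⟨ ℕ∑.sum-permute (λ i → ∑[ j < n ] inverted (π ∘ opposite) i j) reverse ⟩
  ∑[ i < n ] ∑[ j < n ] inverted (π ∘ opposite) (opposite i) j
    ≡⟨ ℕ∑.sum-cong-≗ (λ i → ℕ∑.sum-permute (inverted (π ∘ opposite) (opposite i)) reverse) ⟩
  ∑[ i < n ] ∑[ j < n ] inverted (π ∘ opposite) (opposite i) (opposite j)
    ≡⟨ ℕ∑.sum-cong-≗ (λ i → ℕ∑.sum-cong-≗ (reversed i)) ⟩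
  ∑[ i < n ] ∑[ j < n ] later-smaller i j
    ≡⟨ ℕ∑.∑-comm later-smaller ⟩
  ∑[ j < n ] ∑[ i < n ] later-smaller i j
    ≡⟨ ℕ∑.sum-cong-≗ (λ j → ℕ∑.sum-cong-≗ (complemented j)) ⟩
  ∑[ j < n ] ∑[ i < n ] inverted (opposite ∘ π) j i
    ≡⟨ inv-∑ (opposite ∘ π) ⟨
  inv (opposite ∘ π) ∎
  where
  later-smaller : Fin n → Fin n → ℕ
  later-smaller i j = if (toℕ j <ᵇ toℕ i) ∧ (toℕ (π j) <ᵇ toℕ (π i)) then 1 else 0
  reversed : ∀ i j → inverted (π ∘ opposite) (opposite i) (opposite j) ≡ later-smaller i j
  reversed i j rewrite opposite-<ᵇ i j | opposite-involutive i | opposite-involutive j = refl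
  complemented : ∀ j i → later-smaller i j ≡ inverted (opposite ∘ π) j i
  complemented j i rewrite opposite-<ᵇ (π i) (π j) = refl

sgn-complement : ∀ {n} (π : Fin n → Fin n) → IsPerm π → sgn (inv (opposite ∘ π)) ≡ sgn (pairs n) * sgn (inv π)
sgn-complement {n} π inj = sgn-cancel (inv (opposite ∘ π)) (inv π) (pairs n) (inv-complement π inj)

sgn-reverse : ∀ {n} (π : Fin n → Fin n) → IsPerm π → sgn (inv (π ∘ opposite)) ≡ sgn (pairs n) * sgn (inv π)
sgn-reverse π inj = trans (cong sgn (inv-reverse π)) (sgn-complement π inj)

inSavᵇ : ∀ {k n} → Word k → Word k → (Fin n → Fin n) → Bool
inSavᵇ σ₁ σ₂ π = isPermᵇ π ∧ (not (containsᵇ σ₁ (word π)) ∧ not (containsᵇ σ₂ (word π)))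

∑-Sav : ∀ n {k} (σ₁ σ₂ : Word k) (f : (Fin n → Fin n) → ℤ) →
  ∑[ π ∈ Sav n σ₁ σ₂ ] f π ≡ ∑[ π ∈ allFuns n n ] 𝟙 (inSavᵇ σ₁ σ₂ π) * f π
∑-Sav n σ₁ σ₂ f = begin
  ∑[ π ∈ Sav n σ₁ σ₂ ] f π                                      ≡⟨ ∑-filter (S n) avoids f ⟩
  ∑[ π ∈ S n ] 𝟙 (avoids π) * f π                               ≡⟨ ∑-filter (allFuns n n) isPermᵇ _ ⟩
  ∑[ π ∈ allFuns n n ] 𝟙 (isPermᵇ π) * (𝟙 (avoids π) * f π)     ≡⟨ ∑-cong (allFuns n n) merge ⟩
  ∑[ π ∈ allFuns n n ] 𝟙 (inSavᵇ σ₁ σ₂ π) * f π                 ∎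
  where
  avoids : (Fin n → Fin n) → Bool
  avoids π = not (containsᵇ σ₁ (word π)) ∧ not (containsᵇ σ₂ (word π))
  merge : ∀ π → 𝟙 (isPermᵇ π) * (𝟙 (avoids π) * f π) ≡ 𝟙 (inSavᵇ σ₁ σ₂ π) * f π
  merge π = trans (sym (ℤ.*-assoc (𝟙 (isPermᵇ π)) _ _)) (cong (_* f π) (sym (𝟙-∧ (isPermᵇ π) (avoids π))))

inSavᵇ-cong : ∀ {k n} (σ₁ σ₂ : Word k) {π π′ : Fin n → Fin n} → π ≗ π′ → inSavᵇ σ₁ σ₂ π ≡ inSavᵇ σ₁ σ₂ π′
inSavᵇ-cong σ₁ σ₂ π≗π′ = cong₂ _∧_ (isPermᵇ-cong π≗π′)
  (cong₂ _∧_ (cong not (containsᵇ-cong {σ = σ₁} (λ _ → refl) (cong toℕ ∘ π≗π′)))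
             (cong not (containsᵇ-cong {σ = σ₂} (λ _ → refl) (cong toℕ ∘ π≗π′))))

IsPerm-of-inSavᵇ : ∀ {k n} {σ₁ σ₂ : Word k} {π : Fin n → Fin n} → T (inSavᵇ σ₁ σ₂ π) → IsPerm π
IsPerm-of-inSavᵇ {π = π} t = Equivalence.to (T-isPermᵇ π) (proj₁ (Equivalence.to T-∧ t))

signedCount : ∀ n {k} → Word k → Word k → ℤ
signedCount n σ₁ σ₂ = ∑[ π ∈ allFuns n n ] 𝟙 (inSavᵇ σ₁ σ₂ π) * sgn (inv π)

SignBalanced-of-∑sgn : ∀ {n} (L : List (Fin n → Fin n)) → ∑[ π ∈ L ] sgn (inv π) ≡ 0ℤ → SignBalanced L
SignBalanced-of-∑sgn L ∑≡0 = ℤ.+-injective (begin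
  ℤ.+ #even L                                   ≡⟨ split L ⟩
  (∑[ π ∈ L ] sgn (inv π)) + ℤ.+ #odd L         ≡⟨ cong (_+ ℤ.+ #odd L) ∑≡0 ⟩
  0ℤ + ℤ.+ #odd L                               ≡⟨ ℤ.+-identityˡ _ ⟩
  ℤ.+ #odd L                                    ∎)
  where
  #even #odd : ∀ {n} → List (Fin n → Fin n) → ℕ
  #even L = length (filter (λ π → T? (even? (inv π))) L)
  #odd  L = length (filter (λ π → T? (not (even? (inv π)))) L)

  split : ∀ {n} (L : List (Fin n → Fin n)) → ℤ.+ #even L ≡ (∑[ π ∈ L ] sgn (inv π)) + ℤ.+ #odd L
  split [] = refl
  split (π ∷ L) with even? (inv π)
  ... | true  = trans (cong (1ℤ +_) (split L)) (sym (ℤ.+-assoc 1ℤ (∑[ π ∈ L ] sgn (inv π)) (ℤ.+ #odd L)))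
  ... | false = trans (split L) (shift (∑[ π ∈ L ] sgn (inv π)) (ℤ.+ #odd L))
    where
    shift : ∀ a b → a + b ≡ ℤ.-1ℤ + a + (1ℤ + b)
    shift = solve-∀

SignBalanced-Sav : ∀ n {k} (σ₁ σ₂ : Word k) → signedCount n σ₁ σ₂ ≡ 0ℤ → SignBalanced (Sav n σ₁ σ₂)
SignBalanced-Sav n σ₁ σ₂ count≡0 =
  SignBalanced-of-∑sgn (Sav n σ₁ σ₂) (trans (∑-Sav n σ₁ σ₂ (λ π → sgn (inv π))) count≡0)

-- Reversal and complement

Complements : ∀ {k} → Word k → Word k → Set
Complements σᶜ σ = ∀ {s t} → s <ᶠ t → (σᶜ t <ᵇ σᶜ s) ≡ not (σ t <ᵇ σ s)

Reverses : ∀ {k} → Word k → Word k → Set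
Reverses σʳ σ = ∀ {s t} → s <ᶠ t → (σʳ t <ᵇ σʳ s) ≡ not (σ (opposite s) <ᵇ σ (opposite t))

module _ {k n} {σ σ′ : Word k} {w : Word n} (distinct : ∀ {i j} → i ≢ j → w i ≢ w j) where

  Occurrence-complement : Complements σ′ σ → ∀ {w′ : Word n} → (∀ i j → (w′ i <ᵇ w′ j) ≡ (w j <ᵇ w i)) →
    ∀ {ι} → Occurrence σ w′ ι → Occurrence σ′ w ι
  Occurrence-complement σ′-complements {w′} w′-complements {ι} occ {s} {t} s<t = proj₁ (occ s<t) , (begin
    w (ι t) <ᵇ w (ι s)          ≡⟨ <ᵇ-flip (distinct (<ᶠ⇒≢ (proj₁ (occ s<t)) ∘ sym)) ⟩
    not (w (ι s) <ᵇ w (ι t))    ≡⟨ cong not (w′-complements (ι t) (ι s)) ⟨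
    not (w′ (ι t) <ᵇ w′ (ι s))  ≡⟨ cong not (proj₂ (occ s<t)) ⟩
    not (σ t <ᵇ σ s)            ≡⟨ σ′-complements s<t ⟨
    σ′ t <ᵇ σ′ s                ∎)

  Occurrence-reverse : Reverses σ′ σ → ∀ {ι} → Occurrence σ (w ∘ opposite) ι →
    Occurrence σ′ w (opposite ∘ ι ∘ opposite)
  Occurrence-reverse σ′-reverses {ι} occ {s} {t} s<t = opposite-mono-< ιb<ιa , (begin
    w (opposite (ι b)) <ᵇ w (opposite (ι a))
      ≡⟨ <ᵇ-flip (distinct (<ᶠ⇒≢ (opposite-mono-< ιb<ιa) ∘ sym)) ⟩
    not (w (opposite (ι a)) <ᵇ w (opposite (ι b)))
      ≡⟨ cong not (proj₂ (occ b<a)) ⟩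
    not (σ a <ᵇ σ b)
      ≡⟨ σ′-reverses s<t ⟨
    σ′ t <ᵇ σ′ s ∎)
    where
    a b : Fin k
    a = opposite s
    b = opposite t
    b<a : b <ᶠ a
    b<a = opposite-mono-< s<t
    ιb<ιa : ι b <ᶠ ι a
    ιb<ιa = proj₁ (occ b<a)

module _ {k n} {σ σ′ : Word k} {π : Fin n → Fin n} (inj : IsPerm π) where

  containsᵇ-complement : Complements σ′ σ → Complements σ σ′ →
    containsᵇ σ (word (opposite ∘ π)) ≡ containsᵇ σ′ (word π)
  containsᵇ-complement σ′-complements σ-complements = T-injective (mk⇔
    (λ t → let ι , occ = Equivalence.to (T-containsᵇ σ _) t in
      Equivalence.from (T-containsᵇ σ′ _)
        (ι , Occurrence-complement {σ = σ} {σ′} (word-≢ inj) σ′-complements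
                                    {word (opposite ∘ π)} (λ i j → opposite-<ᵇ (π i) (π j)) occ))
    (λ t → let ι , occ = Equivalence.to (T-containsᵇ σ′ _) t in
      Equivalence.from (T-containsᵇ σ _)
        (ι , Occurrence-complement {σ = σ′} {σ} (word-≢ {π = opposite ∘ π} (inj ∘ opposite-injective)) σ-complements
                                    {word π} (λ i j → sym (opposite-<ᵇ (π j) (π i))) occ)))

  containsᵇ-reverse : Reverses σ′ σ → Reverses σ σ′ →
    containsᵇ σ (word (π ∘ opposite)) ≡ containsᵇ σ′ (word π)
  containsᵇ-reverse σ′-reverses σ-reverses = T-injective (mk⇔
    (λ t → let ι , occ = Equivalence.to (T-containsᵇ σ _) t in
      Equivalence.from (T-containsᵇ σ′ _) (_ , Occurrence-reverse {σ = σ} {σ′} (word-≢ inj) σ′-reverses occ))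
    (λ t → let ι , occ = Equivalence.to (T-containsᵇ σ′ _) t in
      Equivalence.from (T-containsᵇ σ _)
        (_ , Occurrence-reverse {σ = σ′} {σ} (word-≢ {π = π ∘ opposite} (opposite-injective ∘ inj)) σ-reverses
               (Occurrence-cong {σ = σ′} (λ _ → refl) (λ j → cong (toℕ ∘ π) (sym (opposite-involutive j)))
                                (λ _ → refl) occ))))

module _ {n k} (σ₁ σ₂ τ₁ τ₂ : Word k) (φ : (Fin n → Fin n) → (Fin n → Fin n)) (c : ℤ)
         (φ-cong : ∀ {π π′} → π ≗ π′ → φ π ≗ φ π′) (φ-involutive : ∀ π → φ (φ π) ≗ π)
         (φ-perm : ∀ {π} → IsPerm π → IsPerm (φ π))
         (φ-contains₁ : ∀ {π} → IsPerm π → containsᵇ σ₁ (word (φ π)) ≡ containsᵇ τ₁ (word π))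
         (φ-contains₂ : ∀ {π} → IsPerm π → containsᵇ σ₂ (word (φ π)) ≡ containsᵇ τ₂ (word π))
         (φ-sgn : ∀ {π} → IsPerm π → sgn (inv (φ π)) ≡ c * sgn (inv π)) where

  private
    isPermᵇ-φ : ∀ π → isPermᵇ (φ π) ≡ isPermᵇ π
    isPermᵇ-φ π = T-injective (mk⇔
      (λ t → Equivalence.from (T-isPermᵇ π)
               (IsPerm-cong (φ-involutive π) (φ-perm (Equivalence.to (T-isPermᵇ (φ π)) t))))
      (λ t → Equivalence.from (T-isPermᵇ (φ π)) (φ-perm (Equivalence.to (T-isPermᵇ π) t))))

    inSavᵇ-φ : ∀ π → inSavᵇ σ₁ σ₂ (φ π) ≡ inSavᵇ τ₁ τ₂ π
    inSavᵇ-φ π rewrite isPermᵇ-φ π with T? (isPermᵇ π)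
    ... | yes perm rewrite φ-contains₁ (Equivalence.to (T-isPermᵇ π) perm)
                         | φ-contains₂ (Equivalence.to (T-isPermᵇ π) perm) = refl
    ... | no ¬perm rewrite Equivalence.to T-not-≡ (Equivalence.from T-not ¬perm) = refl

    summand : (Fin n → Fin n) → ℤ
    summand π = 𝟙 (inSavᵇ σ₁ σ₂ π) * sgn (inv π)

    summand-φ : ∀ π → summand (φ π) ≡ c * (𝟙 (inSavᵇ τ₁ τ₂ π) * sgn (inv π))
    summand-φ π rewrite inSavᵇ-φ π with inSavᵇ τ₁ τ₂ π in valid
    ... | true  = begin
      1ℤ * sgn (inv (φ π))    ≡⟨ ℤ.*-identityˡ _ ⟩
      sgn (inv (φ π))         ≡⟨ φ-sgn (IsPerm-of-inSavᵇ {σ₁ = τ₁} {τ₂} (subst T (sym valid) tt)) ⟩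
      c * sgn (inv π)         ≡⟨ cong (c *_) (ℤ.*-identityˡ (sgn (inv π))) ⟨
      c * (1ℤ * sgn (inv π))  ∎
    ... | false = sym (ℤ.*-zeroʳ c)

  signedCount-symmetry : signedCount n σ₁ σ₂ ≡ c * signedCount n τ₁ τ₂
  signedCount-symmetry = begin
    ∑[ π ∈ allFuns n n ] summand π
      ≡⟨ ∑-involution (allFuns-enumerates n n) φ flip summand summand-respects ⟨
    ∑[ π ∈ allFuns n n ] summand (φ π)
      ≡⟨ ∑-cong (allFuns n n) summand-φ ⟩
    ∑[ π ∈ allFuns n n ] c * (𝟙 (inSavᵇ τ₁ τ₂ π) * sgn (inv π))
      ≡⟨ ∑-distribˡ-* (allFuns n n) c _ ⟩
    c * signedCount n τ₁ τ₂ ∎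
    where
    flip : ∀ π ρ → (π ≗ᵇ φ ρ) ≡ (ρ ≗ᵇ φ π)
    flip π ρ = T-injective (mk⇔
      (λ t → Equivalence.from T-≗ᵇ λ j → sym (trans (φ-cong (Equivalence.to T-≗ᵇ t) j) (φ-involutive ρ j)))
      (λ t → Equivalence.from T-≗ᵇ λ j → sym (trans (φ-cong (Equivalence.to T-≗ᵇ t) j) (φ-involutive π j))))
    summand-respects : Respects _≗ᵇ_ summand
    summand-respects {π} {π′} t = cong₂ _*_ (cong 𝟙 (inSavᵇ-cong σ₁ σ₂ π≗π′)) (cong sgn (inv-cong π≗π′))
      where
      π≗π′ : π ≗ π′
      π≗π′ = Equivalence.to T-≗ᵇ t

Pairwise : ∀ {k} → (Fin k → Fin k → Set) → Set
Pairwise P = ∀ {s t} → s <ᶠ t → P s t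

pairwise-by-evaluation : ∀ {k} {P : Fin k → Fin k → Set} (P? : ∀ s t → Dec (P s t)) →
  T (allᵇ λ s → allᵇ λ t → not (toℕ s <ᵇ toℕ t) ∨ does (P? s t)) → Pairwise P
pairwise-by-evaluation {P = P} P? check {s} {t} s<t
  with Equivalence.to T-∨ (Equivalence.to (T-allᵇ {p = λ t → not (toℕ s <ᵇ toℕ t) ∨ does (P? s t)})
         (Equivalence.to (T-allᵇ {p = λ s → allᵇ λ t → not (toℕ s <ᵇ toℕ t) ∨ does (P? s t)}) check s) t)
... | inj₁ s≮t = ⊥-elim (Equivalence.to T-not s≮t (<⇒<ᵇ s<t))
... | inj₂ holds with P? s t | holds
...   | yes p | _ = p

reverses? : ∀ {k} (σʳ σ : Word k) s t → Dec ((σʳ t <ᵇ σʳ s) ≡ not (σ (opposite s) <ᵇ σ (opposite t)))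
reverses? σʳ σ s t = (σʳ t <ᵇ σʳ s) Bool.≟ not (σ (opposite s) <ᵇ σ (opposite t))

complements? : ∀ {k} (σᶜ σ : Word k) s t → Dec ((σᶜ t <ᵇ σᶜ s) ≡ not (σ t <ᵇ σ s))
complements? σᶜ σ s t = (σᶜ t <ᵇ σᶜ s) Bool.≟ not (σ t <ᵇ σ s)

Reverses-by-eval : ∀ {k} (σʳ σ : Word k)
  {_ : T (allᵇ λ s → allᵇ λ t → not (toℕ s <ᵇ toℕ t) ∨ does (reverses? σʳ σ s t))} → Reverses σʳ σ
Reverses-by-eval σʳ σ {check} = pairwise-by-evaluation (reverses? σʳ σ) check

Complements-by-eval : ∀ {k} (σᶜ σ : Word k)
  {_ : T (allᵇ λ s → allᵇ λ t → not (toℕ s <ᵇ toℕ t) ∨ does (complements? σᶜ σ s t))} → Complements σᶜ σ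
Complements-by-eval σᶜ σ {check} = pairwise-by-evaluation (complements? σᶜ σ) check

module _ (n : ℕ) {k} (σ₁ σ₂ τ₁ τ₂ : Word k) where

  signedCount-reverse : Reverses τ₁ σ₁ → Reverses σ₁ τ₁ → Reverses τ₂ σ₂ → Reverses σ₂ τ₂ →
    signedCount n σ₁ σ₂ ≡ sgn (pairs n) * signedCount n τ₁ τ₂
  signedCount-reverse τ₁σ₁ σ₁τ₁ τ₂σ₂ σ₂τ₂ = signedCount-symmetry σ₁ σ₂ τ₁ τ₂ (_∘ opposite) (sgn (pairs n))
    (λ π≗π′ j → π≗π′ (opposite j)) (λ π j → cong π (opposite-involutive j)) (λ inj → opposite-injective ∘ inj)
    (λ inj → containsᵇ-reverse inj τ₁σ₁ σ₁τ₁) (λ inj → containsᵇ-reverse inj τ₂σ₂ σ₂τ₂)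
    (λ {π} → sgn-reverse {n} π)

  signedCount-complement : Complements τ₁ σ₁ → Complements σ₁ τ₁ → Complements τ₂ σ₂ → Complements σ₂ τ₂ →
    signedCount n σ₁ σ₂ ≡ sgn (pairs n) * signedCount n τ₁ τ₂
  signedCount-complement τ₁σ₁ σ₁τ₁ τ₂σ₂ σ₂τ₂ = signedCount-symmetry σ₁ σ₂ τ₁ τ₂ (opposite ∘_) (sgn (pairs n))
    (λ π≗π′ j → cong opposite (π≗π′ j)) (λ π j → opposite-involutive (π j)) (λ inj → inj ∘ opposite-injective)
    (λ inj → containsᵇ-complement inj τ₁σ₁ σ₁τ₁) (λ inj → containsᵇ-complement inj τ₂σ₂ σ₂τ₂)
    (λ {π} → sgn-complement {n} π)

-- Inserting the maximum

insertMax : ∀ {n} → Fin (suc n) → (Fin n → Fin n) → Fin (suc n) → Fin (suc n)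
insertMax {n} p τ j with p ≟ j
... | yes _   = fromℕ n
... | no  p≢j = inject₁ (τ (punchOut p≢j))

module _ {n} (p : Fin (suc n)) (τ : Fin n → Fin n) where

  insertMax-at : insertMax p τ p ≡ fromℕ n
  insertMax-at with p ≟ p
  ... | yes _ = refl
  ... | no p≢p = ⊥-elim (p≢p refl)

  insertMax-≢ : ∀ {j} (p≢j : p ≢ j) → insertMax p τ j ≡ inject₁ (τ (punchOut p≢j))
  insertMax-≢ {j} p≢j with p ≟ j
  ... | yes p≡j = ⊥-elim (p≢j p≡j)
  ... | no _    = cong (inject₁ ∘ τ) (punchOut-cong p refl)

  insertMax-punchIn : ∀ j → insertMax p τ (punchIn p j) ≡ inject₁ (τ j)
  insertMax-punchIn j =
    trans (insertMax-≢ (punchInᵢ≢i p j ∘ sym)) (cong (inject₁ ∘ τ) (punchOut-punchIn p))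

  insertMax-max⇒at : ∀ {j} → insertMax p τ j ≡ fromℕ n → p ≡ j
  insertMax-max⇒at {j} eq with p ≟ j
  ... | yes p≡j = p≡j
  ... | no  _   = ⊥-elim (fromℕ≢inject₁ (sym eq))

  insertMax-injective : IsPerm τ → IsPerm (insertMax p τ)
  insertMax-injective inj {i} {j} eq with p ≟ i | p ≟ j
  ... | yes p≡i | yes p≡j = trans (sym p≡i) p≡j
  ... | yes _   | no  _   = ⊥-elim (fromℕ≢inject₁ eq)
  ... | no  _   | yes _   = ⊥-elim (fromℕ≢inject₁ (sym eq))
  ... | no  p≢i | no  p≢j = punchOut-injective p≢i p≢j (inj (inject₁-injective eq))

insertMax-cong : ∀ {n} (p : Fin (suc n)) {τ τ′ : Fin n → Fin n} → τ ≗ τ′ → insertMax p τ ≗ insertMax p τ′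
insertMax-cong p τ≗τ′ j with p ≟ j
... | yes _   = refl
... | no  p≢j = cong inject₁ (τ≗τ′ (punchOut p≢j))

firstWhere : ∀ {m} → (Fin (suc m) → Bool) → Fin (suc m)
firstWhere {zero}  f = zero
firstWhere {suc m} f = if f zero then zero else suc (firstWhere (f ∘ suc))

firstWhere-satisfies : ∀ {m} (f : Fin (suc m) → Bool) j → T (f j) → T (f (firstWhere f))
firstWhere-satisfies {zero}  f zero    fj = fj
firstWhere-satisfies {suc m} f j       fj with f zero in f0
firstWhere-satisfies {suc m} f j       fj | true  = subst T (sym f0) tt
firstWhere-satisfies {suc m} f zero    fj | false = ⊥-elim (subst T f0 fj)
firstWhere-satisfies {suc m} f (suc j) fj | false = firstWhere-satisfies (f ∘ suc) j fj

firstWhere-cong : ∀ {m} {f g : Fin (suc m) → Bool} → f ≗ g → firstWhere f ≡ firstWhere g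
firstWhere-cong {zero}  f≗g = refl
firstWhere-cong {suc m} {f} {g} f≗g rewrite f≗g zero with g zero
... | true  = refl
... | false = cong suc (firstWhere-cong (f≗g ∘ suc))

maxPosition : ∀ {n} → (Fin (suc n) → Fin (suc n)) → Fin (suc n)
maxPosition {n} π = firstWhere (λ j → π j ≟ᵇ fromℕ n)

deleteMax : ∀ {n} → (Fin (suc (suc n)) → Fin (suc (suc n))) → Fin (suc n) → Fin (suc n)
deleteMax {n} π j = pinch (fromℕ n) (π (punchIn (maxPosition π) j))

maxPosition-cong : ∀ {n} {π π′ : Fin (suc n) → Fin (suc n)} → π ≗ π′ → maxPosition π ≡ maxPosition π′
maxPosition-cong π≗π′ = firstWhere-cong (λ j → cong (_≟ᵇ _) (π≗π′ j))

deleteMax-cong : ∀ {n} {π π′ : Fin (suc (suc n)) → Fin (suc (suc n))} → π ≗ π′ → deleteMax π ≗ deleteMax π′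
deleteMax-cong π≗π′ j rewrite maxPosition-cong π≗π′ = cong (pinch _) (π≗π′ _)

module _ {n} (p : Fin (suc n)) (τ : Fin n → Fin n) where

  maxPosition-insertMax : maxPosition (insertMax p τ) ≡ p
  maxPosition-insertMax = sym (insertMax-max⇒at p τ (Equivalence.to T-≟ᵇ
    (firstWhere-satisfies (λ j → insertMax p τ j ≟ᵇ fromℕ n) p (Equivalence.from T-≟ᵇ (insertMax-at p τ)))))

deleteMax-insertMax : ∀ {n} (p : Fin (suc (suc n))) (τ : Fin (suc n) → Fin (suc n)) →
  deleteMax (insertMax p τ) ≗ τ
deleteMax-insertMax p τ j rewrite maxPosition-insertMax p τ | insertMax-punchIn p τ j = pinch-inject₁ (τ j)

module _ {n} (π : Fin (suc (suc n)) → Fin (suc (suc n))) (inj : IsPerm π) where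

  max-attained : ∃ λ j → π j ≡ fromℕ (suc n)
  max-attained with any? (λ j → π j ≟ fromℕ (suc n))
  ... | yes attained = attained
  ... | no  missed with pigeonhole (n<1+n (suc n)) (pinch (fromℕ n) ∘ π)
  ...   | i , j , i<j , same = ⊥-elim (<-irrefl (cong toℕ i≡j) i<j)
    where
    i≡j : i ≡ j
    i≡j = inj (pinch-injective (λ e → missed (i , sym e)) (λ e → missed (j , sym e)) same)

  maxPosition-max : π (maxPosition π) ≡ fromℕ (suc n)
  maxPosition-max = Equivalence.to T-≟ᵇ (firstWhere-satisfies (λ j → π j ≟ᵇ fromℕ (suc n))
    (proj₁ max-attained) (Equivalence.from T-≟ᵇ (proj₂ max-attained)))

  π≢max : ∀ {j} → maxPosition π ≢ j → π j ≢ fromℕ (suc n)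
  π≢max p≢j πj≡max = p≢j (inj (trans maxPosition-max (sym πj≡max)))

  insertMax-deleteMax : π ≗ insertMax (maxPosition π) (deleteMax π)
  insertMax-deleteMax j with maxPosition π ≟ j
  ... | yes p≡j = trans (cong π (sym p≡j)) maxPosition-max
  ... | no  p≢j = sym (begin
    inject₁ (pinch (fromℕ n) (π (punchIn _ (punchOut p≢j))))
      ≡⟨ cong (inject₁ ∘ pinch (fromℕ n) ∘ π) (punchIn-punchOut p≢j) ⟩
    inject₁ (pinch (fromℕ n) (π j))
      ≡⟨ inject₁-pinch (π j) (π≢max p≢j) ⟩
    π j ∎)

  deleteMax-injective : IsPerm (deleteMax π)
  deleteMax-injective {i} {j} eq = punchIn-injective (maxPosition π) i j
    (inj (pinch-injective (π≢max (punchInᵢ≢i _ i ∘ sym) ∘ sym) (π≢max (punchInᵢ≢i _ j ∘ sym) ∘ sym) eq))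

module _ {n} (p : Fin (suc n)) (τ : Fin n → Fin n) where

  word-insertMax-at : word (insertMax p τ) p ≡ n
  word-insertMax-at = trans (cong toℕ (insertMax-at p τ)) (toℕ-fromℕ n)

  word-insertMax-punchIn : ∀ j → word (insertMax p τ) (punchIn p j) ≡ word τ j
  word-insertMax-punchIn j = trans (cong toℕ (insertMax-punchIn p τ j)) (toℕ-inject₁ (τ j))

  word-insertMax-≢ : ∀ {j} (p≢j : p ≢ j) → word (insertMax p τ) j ≡ word τ (punchOut p≢j)
  word-insertMax-≢ p≢j = trans (cong toℕ (insertMax-≢ p τ p≢j)) (toℕ-inject₁ _)

  word-insertMax-< : ∀ {j} → p ≢ j → word (insertMax p τ) j < n
  word-insertMax-< p≢j rewrite word-insertMax-≢ p≢j = toℕ<n _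

  module _ {k} (σ : Word k) where

    Occurrence-insertMax : ∀ {ι} → Occurrence σ (word τ) ι → Occurrence σ (word (insertMax p τ)) (punchIn p ∘ ι)
    Occurrence-insertMax {ι} occ {s} {t} s<t
      rewrite word-insertMax-punchIn (ι s) | word-insertMax-punchIn (ι t) =
      punchIn-mono-< p (proj₁ (occ s<t)) , proj₂ (occ s<t)

    Occurrence-deleteMax : ∀ {ι} (p∉ι : ∀ s → p ≢ ι s) →
      Occurrence σ (word (insertMax p τ)) ι → Occurrence σ (word τ) (λ s → punchOut (p∉ι s))
    Occurrence-deleteMax {ι} p∉ι occ {s} {t} s<t
      rewrite sym (word-insertMax-≢ (p∉ι s)) | sym (word-insertMax-≢ (p∉ι t)) =
      punchOut-mono-< (p∉ι s) (p∉ι t) (proj₁ (occ s<t)) , proj₂ (occ s<t)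

    Occurrence-at-max : ∀ {ι} → Occurrence σ (word (insertMax p τ)) ι →
      ∀ {s t} → ι s ≡ p → s <ᶠ t → (σ t <ᵇ σ s) ≡ true
    Occurrence-at-max {ι} occ {s} {t} ιs≡p s<t = begin
      σ t <ᵇ σ s
        ≡⟨ proj₂ (occ s<t) ⟨
      word (insertMax p τ) (ι t) <ᵇ word (insertMax p τ) (ι s)
        ≡⟨ cong (word (insertMax p τ) (ι t) <ᵇ_) (trans (cong (word (insertMax p τ)) ιs≡p) word-insertMax-at) ⟩
      word (insertMax p τ) (ι t) <ᵇ n
        ≡⟨ <ᵇ-true (word-insertMax-< p≢ιt) ⟩
      true ∎
      where
      p≢ιt : p ≢ ι t
      p≢ιt p≡ιt = <-irrefl (cong toℕ (trans ιs≡p p≡ιt)) (proj₁ (occ s<t))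

    containsᵇ-insertMax : T (containsᵇ σ (word τ)) → T (containsᵇ σ (word (insertMax p τ)))
    containsᵇ-insertMax t with Equivalence.to (T-containsᵇ σ _) t
    ... | ι , occ = Equivalence.from (T-containsᵇ σ _) (punchIn p ∘ ι , Occurrence-insertMax occ)

    containsᵇ-insertMax-cases : T (containsᵇ σ (word (insertMax p τ))) →
      T (containsᵇ σ (word τ)) ⊎ ∃ λ ι → Occurrence σ (word (insertMax p τ)) ι × ∃ λ s → ι s ≡ p
    containsᵇ-insertMax-cases t with Equivalence.to (T-containsᵇ σ _) t
    ... | ι , occ with any? (λ s → p ≟ ι s)
    ... | yes (s , p≡ιs) = inj₂ (ι , occ , s , sym p≡ιs)
    ... | no  p∉ι = inj₁ (Equivalence.from (T-containsᵇ σ _)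
                      (_ , Occurrence-deleteMax (λ s p≡ιs → p∉ι (s , p≡ιs)) occ))

∑-later-positions : ∀ {n} (p : Fin (suc n)) → ∑[ j < n ] (if toℕ p <ᵇ toℕ (punchIn p j) then 1 else 0) ≡ n ∸ toℕ p
∑-later-positions {n}     zero    = ∑-ones n
  where
  ∑-ones : ∀ m → ∑[ j < m ] 1 ≡ m
  ∑-ones zero    = refl
  ∑-ones (suc m) = cong suc (∑-ones m)
∑-later-positions {suc n} (suc p) = ∑-later-positions p

inv-insertMax : ∀ {n} (p : Fin (suc n)) (τ : Fin n → Fin n) → inv (insertMax p τ) ≡ (n ∸ toℕ p) ℕ.+ inv τ
inv-insertMax {n} p τ = begin
  inv π
    ≡⟨ inv-∑ π ⟩
  ∑[ i < suc n ] ∑[ j < suc n ] inverted π i j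
    ≡⟨ ℕ∑.sum-remove {i = p} (λ i → ∑[ j < suc n ] inverted π i j) ⟩
  (∑[ j < suc n ] inverted π p j) ℕ.+ (∑[ i < n ] ∑[ j < suc n ] inverted π (punchIn p i) j)
                                                                       ≡⟨ cong₂ ℕ._+_ row-of-max (ℕ∑.sum-cong-≗ other-row) ⟩
  (n ∸ toℕ p) ℕ.+ (∑[ i < n ] ∑[ j < n ] inverted τ i j)
    ≡⟨ cong ((n ∸ toℕ p) ℕ.+_) (inv-∑ τ) ⟨
  (n ∸ toℕ p) ℕ.+ inv τ ∎
  where
  π : Fin (suc n) → Fin (suc n)
  π = insertMax p τ

  row-of-max : ∑[ j < suc n ] inverted π p j ≡ n ∸ toℕ p
  row-of-max = begin
    ∑[ j < suc n ] inverted π p j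
      ≡⟨ ℕ∑.sum-remove {i = p} (inverted π p) ⟩
    inverted π p p ℕ.+ (∑[ j < n ] inverted π p (punchIn p j))
      ≡⟨ cong₂ ℕ._+_ diagonal (ℕ∑.sum-cong-≗ entry) ⟩
    ∑[ j < n ] (if toℕ p <ᵇ toℕ (punchIn p j) then 1 else 0)
      ≡⟨ ∑-later-positions p ⟩
    n ∸ toℕ p ∎
    where
    diagonal : inverted π p p ≡ 0
    diagonal rewrite <ᵇ-false (<-irrefl (refl {x = toℕ p})) = refl
    entry : ∀ j → inverted π p (punchIn p j) ≡ (if toℕ p <ᵇ toℕ (punchIn p j) then 1 else 0)
    entry j rewrite word-insertMax-punchIn p τ j | word-insertMax-at p τ | <ᵇ-true (toℕ<n (τ j))
                  | ∧-identityʳ (toℕ p <ᵇ toℕ (punchIn p j)) = refl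

  other-row : ∀ i → ∑[ j < suc n ] inverted π (punchIn p i) j ≡ ∑[ j < n ] inverted τ i j
  other-row i = begin
    ∑[ j < suc n ] inverted π (punchIn p i) j
      ≡⟨ ℕ∑.sum-remove {i = p} (inverted π (punchIn p i)) ⟩
    inverted π (punchIn p i) p ℕ.+ (∑[ j < n ] inverted π (punchIn p i) (punchIn p j))
                                                                               ≡⟨ cong₂ ℕ._+_ max-after (ℕ∑.sum-cong-≗ entry) ⟩
    ∑[ j < n ] inverted τ i j ∎
    where
    max-after : inverted π (punchIn p i) p ≡ 0
    max-after rewrite word-insertMax-punchIn p τ i | word-insertMax-at p τ | <ᵇ-false (<⇒≯ (toℕ<n (τ i)))
                    | ∧-zeroʳ (toℕ (punchIn p i) <ᵇ toℕ p) = refl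
    entry : ∀ j → inverted π (punchIn p i) (punchIn p j) ≡ inverted τ i j
    entry j rewrite word-insertMax-punchIn p τ i | word-insertMax-punchIn p τ j | punchIn-<ᵇ p i j = refl

-- Patterns of length four and monotone triples

-- iₛₜ records whether positions s < t of a word of length four form an inversion.
record Inversions₄ : Set where
  constructor inversions
  field
    i01 i02 i03 i12 i13 i23 : Bool

open Inversions₄

inversions₄ : ℕ → ℕ → ℕ → ℕ → Inversions₄
inversions₄ a b c d = inversions (b <ᵇ a) (c <ᵇ a) (d <ᵇ a) (c <ᵇ b) (d <ᵇ b) (d <ᵇ c)

prefix : ∀ {k} → (Fin (4 ℕ.+ k) → Fin (4 ℕ.+ k)) → Inversions₄
prefix π = inversions₄ (word π 0F) (word π 1F) (word π 2F) (word π 3F)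

module _ {n x y z : ℕ} (x<n : x < n) (y<n : y < n) (z<n : z < n) where

  inversions₄-max₀ : inversions₄ n x y z ≡ inversions true true true (y <ᵇ x) (z <ᵇ x) (z <ᵇ y)
  inversions₄-max₀ rewrite <ᵇ-true x<n | <ᵇ-true y<n | <ᵇ-true z<n = refl

  inversions₄-max₁ : inversions₄ x n y z ≡ inversions false (y <ᵇ x) (z <ᵇ x) true true (z <ᵇ y)
  inversions₄-max₁ rewrite <ᵇ-false (<⇒≯ x<n) | <ᵇ-true y<n | <ᵇ-true z<n = refl

  inversions₄-max₂ : inversions₄ x y n z ≡ inversions (y <ᵇ x) false (z <ᵇ x) false (z <ᵇ y) true
  inversions₄-max₂ rewrite <ᵇ-false (<⇒≯ x<n) | <ᵇ-false (<⇒≯ y<n) | <ᵇ-true z<n = refl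

  inversions₄-max₃ : inversions₄ x y z n ≡ inversions (y <ᵇ x) (z <ᵇ x) false (z <ᵇ y) false false
  inversions₄-max₃ rewrite <ᵇ-false (<⇒≯ x<n) | <ᵇ-false (<⇒≯ y<n) | <ᵇ-false (<⇒≯ z<n) = refl

positions₄ : ∀ {n} → Fin n → Fin n → Fin n → Fin n → Fin 4 → Fin n
positions₄ a b c d 0F = a
positions₄ a b c d 1F = b
positions₄ a b c d 2F = c
positions₄ a b c d 3F = d

module _ {n} (σ : Word 4) (w : Word n) {a b c d : Fin n} where

  Occurrence₄ : a <ᶠ b → b <ᶠ c → c <ᶠ d →
    inversions₄ (w a) (w b) (w c) (w d) ≡ inversions₄ (σ 0F) (σ 1F) (σ 2F) (σ 3F) →
    Occurrence σ w (positions₄ a b c d)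
  Occurrence₄ a<b b<c c<d same {0F} {1F} _ = a<b , cong i01 same
  Occurrence₄ a<b b<c c<d same {0F} {2F} _ = <-trans a<b b<c , cong i02 same
  Occurrence₄ a<b b<c c<d same {0F} {3F} _ = <-trans a<b (<-trans b<c c<d) , cong i03 same
  Occurrence₄ a<b b<c c<d same {1F} {2F} _ = b<c , cong i12 same
  Occurrence₄ a<b b<c c<d same {1F} {3F} _ = <-trans b<c c<d , cong i13 same
  Occurrence₄ a<b b<c c<d same {2F} {3F} _ = c<d , cong i23 same
  Occurrence₄ _ _ _ _ {_} {0F} ()
  Occurrence₄ _ _ _ _ {suc _} {1F} (s≤s ())
  Occurrence₄ _ _ _ _ {suc (suc _)} {2F} (s≤s (s≤s ()))
  Occurrence₄ _ _ _ _ {suc (suc (suc _))} {3F} (s≤s (s≤s (s≤s ())))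

Monotone : {A : Set} → (A → A → Set) → A → A → A → Set
Monotone _≺_ x y z = (x ≺ y × y ≺ z) ⊎ (y ≺ x × z ≺ y)

¬xor-of-monotone : ∀ {x y z} → Monotone _<_ x y z → ¬ T ((y <ᵇ x) xor (z <ᵇ y))
¬xor-of-monotone (inj₁ (x<y , y<z)) rewrite <ᵇ-false (<⇒≯ x<y) | <ᵇ-false (<⇒≯ y<z) = λ ()
¬xor-of-monotone (inj₂ (y<x , z<y)) rewrite <ᵇ-true y<x | <ᵇ-true z<y = λ ()

monotone-of-¬xor : ∀ {x y z} → x ≢ y → y ≢ z → ¬ T ((y <ᵇ x) xor (z <ᵇ y)) → Monotone _<_ x y z
monotone-of-¬xor {x} {y} {z} x≢y y≢z ¬xor with y <ᵇ x in yx | z <ᵇ y in zy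
... | true  | true  = inj₂ (<ᵇ⇒< y x (subst T (sym yx) tt) , <ᵇ⇒< z y (subst T (sym zy) tt))
... | false | false = inj₁ (≤∧≢⇒< (≮⇒≥ (λ y<x → subst T yx (<⇒<ᵇ y<x))) x≢y ,
                           ≤∧≢⇒< (≮⇒≥ (λ z<y → subst T zy (<⇒<ᵇ z<y))) y≢z)
... | true  | false = ⊥-elim (¬xor tt)
... | false | true  = ⊥-elim (¬xor tt)

record MonotoneTriple {A : Set} (_≺_ : A → A → Set) {N} (w : Fin N → A) (bound : ℕ) : Set where
  constructor monotoneTriple
  field
    {a b c}  : Fin N
    a<b      : a <ᶠ b
    b<c      : b <ᶠ c
    c<bound  : toℕ c < bound
    monotone : Monotone _≺_ (w a) (w b) (w c)

MonotoneTriple-weaken : ∀ {A} {_≺_ : A → A → Set} {N} {w : Fin N → A} {m n} →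
  m ≤ n → MonotoneTriple _≺_ w m → MonotoneTriple _≺_ w n
MonotoneTriple-weaken m≤n (monotoneTriple a<b b<c c<m mono) = monotoneTriple a<b b<c (<-≤-trans c<m m≤n) mono

MonotoneTriple-flip : ∀ {A} {_≺_ : A → A → Set} {N} {w : Fin N → A} {bound} →
  MonotoneTriple (λ x y → y ≺ x) w bound → MonotoneTriple _≺_ w bound
MonotoneTriple-flip (monotoneTriple a<b b<c c<bound (inj₁ (yx , zy))) = monotoneTriple a<b b<c c<bound (inj₂ (yx , zy))
MonotoneTriple-flip (monotoneTriple a<b b<c c<bound (inj₂ (xy , yz))) = monotoneTriple a<b b<c c<bound (inj₁ (xy , yz))

MonotoneTriple-3≤ : ∀ {A} {_≺_ : A → A → Set} {N} {w : Fin N → A} {bound} → MonotoneTriple _≺_ w bound → 3 ≤ bound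
MonotoneTriple-3≤ (monotoneTriple a<b b<c c<bound _) =
  ≤-trans (s≤s (≤-trans (s≤s (≤-trans (s≤s z≤n) a<b)) b<c)) c<bound

module ErdősSzekeres₅ {A : Set} {_≺_ : A → A → Set} {k} (w : Fin (5 ℕ.+ k) → A)
                      (compare : ∀ {i j} → i ≢ j → w i ≺ w j ⊎ w j ≺ w i) where

  from-ascent : w 0F ≺ w 1F → MonotoneTriple _≺_ w 5
  from-ascent w0≺w1 with compare {1F} {2F} (λ ())
  ... | inj₁ w1≺w2 = monotoneTriple {a = 0F} {1F} {2F} <-by-eval <-by-eval <-by-eval (inj₁ (w0≺w1 , w1≺w2))
  ... | inj₂ w2≺w1 with compare {1F} {3F} (λ ())
  ...   | inj₁ w1≺w3 = monotoneTriple {a = 0F} {1F} {3F} <-by-eval <-by-eval <-by-eval (inj₁ (w0≺w1 , w1≺w3))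
  ...   | inj₂ w3≺w1 with compare {2F} {3F} (λ ())
  ...     | inj₂ w3≺w2 = monotoneTriple {a = 1F} {2F} {3F} <-by-eval <-by-eval <-by-eval (inj₂ (w2≺w1 , w3≺w2))
  ...     | inj₁ w2≺w3 with compare {1F} {4F} (λ ())
  ...       | inj₁ w1≺w4 = monotoneTriple {a = 0F} {1F} {4F} <-by-eval <-by-eval <-by-eval (inj₁ (w0≺w1 , w1≺w4))
  ...       | inj₂ w4≺w1 with compare {3F} {4F} (λ ())
  ...         | inj₁ w3≺w4 = monotoneTriple {a = 2F} {3F} {4F} <-by-eval <-by-eval <-by-eval (inj₁ (w2≺w3 , w3≺w4))
  ...         | inj₂ w4≺w3 = monotoneTriple {a = 1F} {3F} {4F} <-by-eval <-by-eval <-by-eval (inj₂ (w3≺w1 , w4≺w3))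

monotoneTriple₅ : ∀ {k} (τ : Fin (5 ℕ.+ k) → Fin (5 ℕ.+ k)) → IsPerm τ → MonotoneTriple _<_ (word τ) 5
monotoneTriple₅ τ inj with word-compare inj {0F} {1F} (λ ())
... | inj₁ w0<w1 = ErdősSzekeres₅.from-ascent (word τ) (word-compare inj) w0<w1
... | inj₂ w1<w0 = MonotoneTriple-flip (ErdősSzekeres₅.from-ascent (word τ) (swap ∘ word-compare inj) w1<w0)

monotoneTriple-of-¬xor : ∀ {N} {π : Fin N → Fin N} → IsPerm π → ∀ {a b c bound} →
  a <ᶠ b → b <ᶠ c → toℕ c < bound → ¬ T ((word π b <ᵇ word π a) xor (word π c <ᵇ word π b)) →
  MonotoneTriple _<_ (word π) bound
monotoneTriple-of-¬xor inj a<b b<c c<bound ¬xor = monotoneTriple a<b b<c c<bound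
  (monotone-of-¬xor (word-≢ inj (<ᶠ⇒≢ a<b)) (word-≢ inj (<ᶠ⇒≢ b<c)) ¬xor)

-- The four triples of positions in a word of length 4, numbered 012, 013, 023, 123; for distinct
-- values a triple is monotone iff its two consecutive pairs are both inversions or both not.
nonMonotoneᵇ : Inversions₄ → Fin 4 → Bool
nonMonotoneᵇ B 0F = i01 B xor i12 B
nonMonotoneᵇ B 1F = i01 B xor i13 B
nonMonotoneᵇ B 2F = i02 B xor i23 B
nonMonotoneᵇ B 3F = i12 B xor i23 B

-- Inserting the maximum at position p keeps 1234 and 3214 avoided iff the first p entries contain no
-- monotone triple, which never holds for p ≥ 5 (Erdős–Szekeres); for p ≤ 4 it depends only on the
-- inversions among the first four entries.
admissible : Inversions₄ → ℕ → Bool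
admissible B 0 = true
admissible B 1 = true
admissible B 2 = true
admissible B 3 = nonMonotoneᵇ B 0F
admissible B 4 = allᵇ (nonMonotoneᵇ B)
admissible B (suc (suc (suc (suc (suc _))))) = false

data Triple₄ {k} : Fin (4 ℕ.+ k) → Fin (4 ℕ.+ k) → Fin (4 ℕ.+ k) → Set where
  t012 : Triple₄ 0F 1F 2F
  t013 : Triple₄ 0F 1F 3F
  t023 : Triple₄ 0F 2F 3F
  t123 : Triple₄ 1F 2F 3F

triple₄ : ∀ {k} {a b c : Fin (4 ℕ.+ k)} → a <ᶠ b → b <ᶠ c → toℕ c < 4 → Triple₄ a b c
triple₄ {a = 0F} {1F} {2F} _ _ _ = t012
triple₄ {a = 0F} {1F} {3F} _ _ _ = t013
triple₄ {a = 0F} {2F} {3F} _ _ _ = t023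
triple₄ {a = 1F} {2F} {3F} _ _ _ = t123
triple₄ {c = suc (suc (suc (suc _)))} _ _ (s≤s (s≤s (s≤s (s≤s ()))))
triple₄ {a = suc (suc _)} {2F} (s≤s (s≤s ())) _ _
triple₄ {a = suc _} {1F} (s≤s ()) _ _
triple₄ {b = suc (suc (suc _))} {3F} _ (s≤s (s≤s (s≤s ()))) _
triple₄ {b = suc (suc _)} {2F} _ (s≤s (s≤s ())) _
triple₄ {b = suc _} {1F} _ (s≤s ()) _
triple₄ {b = 0F} ()

admissible-¬monotone : ∀ {k} (τ : Fin (4 ℕ.+ k) → Fin (4 ℕ.+ k)) bound →
  T (admissible (prefix τ) bound) → ¬ MonotoneTriple _<_ (word τ) bound
admissible-¬monotone τ 0 _ t = <⇒≱ <-by-eval (MonotoneTriple-3≤ t)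
admissible-¬monotone τ 1 _ t = <⇒≱ <-by-eval (MonotoneTriple-3≤ t)
admissible-¬monotone τ 2 _ t = <⇒≱ <-by-eval (MonotoneTriple-3≤ t)
admissible-¬monotone τ 3 adm (monotoneTriple a<b b<c c<3 mono) with triple₄ a<b b<c (<-trans c<3 <-by-eval)
... | t012 = ¬xor-of-monotone mono adm
... | t013 = <-irrefl refl c<3
... | t023 = <-irrefl refl c<3
... | t123 = <-irrefl refl c<3
admissible-¬monotone τ 4 adm (monotoneTriple a<b b<c c<4 mono)
  with triple₄ a<b b<c c<4 | Equivalence.to (T-allᵇ {p = nonMonotoneᵇ (prefix τ)}) adm
... | t012 | free = ¬xor-of-monotone mono (free 0F)
... | t013 | free = ¬xor-of-monotone mono (free 1F)
... | t023 | free = ¬xor-of-monotone mono (free 2F)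
... | t123 | free = ¬xor-of-monotone mono (free 3F)
admissible-¬monotone τ (suc (suc (suc (suc (suc _))))) ()

¬admissible-monotone : ∀ {k} (τ : Fin (4 ℕ.+ k) → Fin (4 ℕ.+ k)) → IsPerm τ → ∀ bound → bound ≤ 4 ℕ.+ k →
  ¬ T (admissible (prefix τ) bound) → MonotoneTriple _<_ (word τ) bound
¬admissible-monotone τ inj 0 _ ¬adm = ⊥-elim (¬adm tt)
¬admissible-monotone τ inj 1 _ ¬adm = ⊥-elim (¬adm tt)
¬admissible-monotone τ inj 2 _ ¬adm = ⊥-elim (¬adm tt)
¬admissible-monotone τ inj 3 _ ¬adm =
  monotoneTriple-of-¬xor inj {0F} {1F} {2F} <-by-eval <-by-eval <-by-eval ¬adm
¬admissible-monotone τ inj 4 _ ¬adm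
  with allᵇ-counterexample {p = nonMonotoneᵇ (prefix τ)} ¬adm
... | 0F , ¬free = monotoneTriple-of-¬xor inj {0F} {1F} {2F} <-by-eval <-by-eval <-by-eval ¬free
... | 1F , ¬free = monotoneTriple-of-¬xor inj {0F} {1F} {3F} <-by-eval <-by-eval <-by-eval ¬free
... | 2F , ¬free = monotoneTriple-of-¬xor inj {0F} {2F} {3F} <-by-eval <-by-eval <-by-eval ¬free
... | 3F , ¬free = monotoneTriple-of-¬xor inj {1F} {2F} {3F} <-by-eval <-by-eval <-by-eval ¬free
¬admissible-monotone {zero} τ inj (suc (suc (suc (suc (suc _))))) (s≤s (s≤s (s≤s (s≤s ())))) _
¬admissible-monotone {suc k} τ inj (suc (suc (suc (suc (suc b))))) _ _ =
  MonotoneTriple-weaken (s≤s (s≤s (s≤s (s≤s (s≤s z≤n))))) (monotoneTriple₅ τ inj)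

p1234 p3214 : Word 4
p1234 = pat 1 2 3 4
p3214 = pat 3 2 1 4

module _ {n} (p : Fin (suc n)) (τ : Fin n → Fin n) where

  monotone⇒contains : MonotoneTriple _<_ (word τ) (toℕ p) →
    T (containsᵇ p1234 (word (insertMax p τ))) ⊎ T (containsᵇ p3214 (word (insertMax p τ)))
  monotone⇒contains (monotoneTriple {a} {b} {c} a<b b<c c<p mono) = byDirection mono
    where
    w : Word (suc n)
    w = word (insertMax p τ)

    shape : Inversions₄
    shape = inversions (word τ b <ᵇ word τ a) (word τ c <ᵇ word τ a) false (word τ c <ᵇ word τ b) false false

    inserted : inversions₄ (w (punchIn p a)) (w (punchIn p b)) (w (punchIn p c)) (w p) ≡ shape
    inserted rewrite word-insertMax-punchIn p τ a | word-insertMax-punchIn p τ b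
                   | word-insertMax-punchIn p τ c | word-insertMax-at p τ =
      inversions₄-max₃ (toℕ<n (τ a)) (toℕ<n (τ b)) (toℕ<n (τ c))

    contains : (σ : Word 4) → shape ≡ inversions₄ (σ 0F) (σ 1F) (σ 2F) (σ 3F) → T (containsᵇ σ w)
    contains σ same = Equivalence.from (T-containsᵇ σ w) (positions₄ (punchIn p a) (punchIn p b) (punchIn p c) p ,
      Occurrence₄ σ w (punchIn-mono-< p a<b) (punchIn-mono-< p b<c)
                      (subst (_< toℕ p) (sym (toℕ-punchIn-< p c<p)) c<p) (trans inserted same))

    increasing : word τ a < word τ b → word τ b < word τ c → shape ≡ inversions₄ 1 2 3 4
    increasing ab bc rewrite <ᵇ-false (<⇒≯ ab) | <ᵇ-false (<⇒≯ (<-trans ab bc)) | <ᵇ-false (<⇒≯ bc) = refl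

    decreasing : word τ b < word τ a → word τ c < word τ b → shape ≡ inversions₄ 3 2 1 4
    decreasing ba cb rewrite <ᵇ-true ba | <ᵇ-true (<-trans cb ba) | <ᵇ-true cb = refl

    byDirection : Monotone _<_ (word τ a) (word τ b) (word τ c) →
      T (containsᵇ p1234 w) ⊎ T (containsᵇ p3214 w)
    byDirection (inj₁ (ab , bc)) = inj₁ (contains p1234 (increasing ab bc))
    byDirection (inj₂ (ba , cb)) = inj₂ (contains p3214 (decreasing ba cb))

-- The hypotheses say that σ ends with its maximum and starts with a monotone triple, as 1234 and
-- 3214 do.
module _ (σ : Word 4) (max-last : ∀ (s : Fin 4) → toℕ s < 3 → (σ 3F <ᵇ σ s) ≡ false)
         (monotone-start : ¬ T ((σ 1F <ᵇ σ 0F) xor (σ 2F <ᵇ σ 1F)))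
         {n} (p : Fin (suc n)) (τ : Fin n → Fin n) (inj : IsPerm τ) where

  contains⇒monotone : T (containsᵇ σ (word (insertMax p τ))) →
    T (containsᵇ σ (word τ)) ⊎ MonotoneTriple _<_ (word τ) (toℕ p)
  contains⇒monotone t with containsᵇ-insertMax-cases p τ σ t
  ... | inj₁ t′ = inj₁ t′
  ... | inj₂ (ι , occ , s , ιs≡p) = inj₂ (through s ιs≡p)
    where
    at-last : ι 3F ≡ p → MonotoneTriple _<_ (word τ) (toℕ p)
    at-last ι3≡p = monotoneTriple a′<b′ b′<c′ c′<p
      (monotone-of-¬xor (word-≢ inj (<ᶠ⇒≢ a′<b′)) (word-≢ inj (<ᶠ⇒≢ b′<c′)) ¬xor)
      where
      before : ∀ {s} → toℕ s < 3 → ι s <ᶠ p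
      before s<3 = subst (_ <ᶠ_) ι3≡p (proj₁ (occ s<3))
      p≢ : ∀ {s} → toℕ s < 3 → p ≢ ι s
      p≢ s<3 p≡ιs = <ᶠ⇒≢ (before s<3) (sym p≡ιs)
      p≢ι0 : p ≢ ι 0F
      p≢ι0 = p≢ <-by-eval
      p≢ι1 : p ≢ ι 1F
      p≢ι1 = p≢ <-by-eval
      p≢ι2 : p ≢ ι 2F
      p≢ι2 = p≢ <-by-eval
      a′<b′ : punchOut p≢ι0 <ᶠ punchOut p≢ι1
      a′<b′ = punchOut-mono-< p≢ι0 p≢ι1 (proj₁ (occ {0F} {1F} <-by-eval))
      b′<c′ : punchOut p≢ι1 <ᶠ punchOut p≢ι2
      b′<c′ = punchOut-mono-< p≢ι1 p≢ι2 (proj₁ (occ {1F} {2F} <-by-eval))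
      c′<p : toℕ (punchOut p≢ι2) < toℕ p
      c′<p = ≤-<-trans (toℕ-punchOut-≤ p≢ι2) (before <-by-eval)
      ¬xor : ¬ T ((word τ (punchOut p≢ι1) <ᵇ word τ (punchOut p≢ι0)) xor
                  (word τ (punchOut p≢ι2) <ᵇ word τ (punchOut p≢ι1)))
      ¬xor rewrite sym (word-insertMax-≢ p τ p≢ι0) | sym (word-insertMax-≢ p τ p≢ι1)
                 | sym (word-insertMax-≢ p τ p≢ι2)
                 | proj₂ (occ {0F} {1F} <-by-eval) | proj₂ (occ {1F} {2F} <-by-eval) = monotone-start

    not-before-last : ∀ {s} → ι s ≡ p → toℕ s < 3 → MonotoneTriple _<_ (word τ) (toℕ p)
    not-before-last {s} ιs≡p s<3 =
      ⊥-elim (true≢false (trans (sym (Occurrence-at-max p τ σ occ ιs≡p s<3)) (max-last s s<3)))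

    through : ∀ s → ι s ≡ p → MonotoneTriple _<_ (word τ) (toℕ p)
    through 3F ι3≡p = at-last ι3≡p
    through 0F ι0≡p = not-before-last ι0≡p <-by-eval
    through 1F ι1≡p = not-before-last ι1≡p <-by-eval
    through 2F ι2≡p = not-before-last ι2≡p <-by-eval

avoidsᵇ : ∀ {n} → (Fin n → Fin n) → Bool
avoidsᵇ π = not (containsᵇ p1234 (word π)) ∧ not (containsᵇ p3214 (word π))

module _ {k} (p : Fin (5 ℕ.+ k)) (τ : Fin (4 ℕ.+ k) → Fin (4 ℕ.+ k)) (inj : IsPerm τ) where

  private
    π : Fin (5 ℕ.+ k) → Fin (5 ℕ.+ k)
    π = insertMax p τ
    adm : Bool
    adm = admissible (prefix τ) (toℕ p)

    contains⇒monotone₁ : T (containsᵇ p1234 (word π)) →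
      T (containsᵇ p1234 (word τ)) ⊎ MonotoneTriple _<_ (word τ) (toℕ p)
    contains⇒monotone₁ = contains⇒monotone p1234
      (λ { 0F _ → refl ; 1F _ → refl ; 2F _ → refl ; 3F (s≤s (s≤s (s≤s ()))) }) (λ ()) p τ inj

    contains⇒monotone₂ : T (containsᵇ p3214 (word π)) →
      T (containsᵇ p3214 (word τ)) ⊎ MonotoneTriple _<_ (word τ) (toℕ p)
    contains⇒monotone₂ = contains⇒monotone p3214
      (λ { 0F _ → refl ; 1F _ → refl ; 2F _ → refl ; 3F (s≤s (s≤s (s≤s ()))) }) (λ ()) p τ inj

  avoidsᵇ-insertMax : T (avoidsᵇ π) ⇔ T (adm ∧ avoidsᵇ τ)
  avoidsᵇ-insertMax = mk⇔
    (λ t → let ¬c₁ , ¬c₂ = Equivalence.to T-not∧not t in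
      Equivalence.from T-∧ (admissible-by-contradiction ¬c₁ ¬c₂ ,
                            Equivalence.from T-not∧not (¬c₁ ∘ containsᵇ-insertMax p τ p1234 ,
                                                       ¬c₂ ∘ containsᵇ-insertMax p τ p3214)))
    (λ t → let a , ¬d = Equivalence.to (T-∧ {adm}) t ; ¬d₁ , ¬d₂ = Equivalence.to T-not∧not ¬d in
      Equivalence.from T-not∧not ((λ c₁ → [ ¬d₁ , admissible-¬monotone τ (toℕ p) a ] (contains⇒monotone₁ c₁)) ,
                                 (λ c₂ → [ ¬d₂ , admissible-¬monotone τ (toℕ p) a ] (contains⇒monotone₂ c₂))))
    where
    admissible-by-contradiction : ¬ T (containsᵇ p1234 (word π)) → ¬ T (containsᵇ p3214 (word π)) → T adm
    admissible-by-contradiction ¬c₁ ¬c₂ with T? adm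
    ... | yes a = a
    ... | no ¬a = ⊥-elim ([ ¬c₁ , ¬c₂ ] (monotone⇒contains p τ
                   (¬admissible-monotone τ inj (toℕ p) (ℕ.s≤s⁻¹ (toℕ<n p)) ¬a)))

  inSavᵇ-insertMax : inSavᵇ p1234 p3214 π ≡ adm ∧ inSavᵇ p1234 p3214 τ
  inSavᵇ-insertMax = begin
    isPermᵇ π ∧ avoidsᵇ π            ≡⟨ cong (_∧ avoidsᵇ π) (isPermᵇ-true (insertMax-injective p τ inj)) ⟩
    avoidsᵇ π                        ≡⟨ T-injective avoidsᵇ-insertMax ⟩
    adm ∧ avoidsᵇ τ                  ≡⟨ cong (λ b → adm ∧ (b ∧ avoidsᵇ τ)) (isPermᵇ-true inj) ⟨
    adm ∧ (isPermᵇ τ ∧ avoidsᵇ τ)    ∎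

module _ {k} (π : Fin (5 ℕ.+ k) → Fin (5 ℕ.+ k)) (τ : Fin (4 ℕ.+ k) → Fin (4 ℕ.+ k)) (p : Fin (5 ℕ.+ k)) where

  private
    valid : Bool
    valid = admissible (prefix τ) (toℕ p) ∧ inSavᵇ p1234 p3214 τ

    inverse : Bool
    inverse = (τ ≗ᵇ deleteMax π) ∧ (p ≟ᵇ maxPosition π)

  insertMax-graph⇒ : T (valid ∧ (π ≗ᵇ insertMax p τ)) → T (inSavᵇ p1234 p3214 π ∧ inverse)
  insertMax-graph⇒ t = Equivalence.from T-∧ (subst T (sym in-Sav) valid-τ ,
                         Equivalence.from T-∧ (Equivalence.from T-≗ᵇ τ≗ , Equivalence.from T-≟ᵇ p≡))
    where
    valid-τ : T valid
    valid-τ = proj₁ (Equivalence.to T-∧ t)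
    injτ : IsPerm τ
    injτ = IsPerm-of-inSavᵇ {σ₁ = p1234} {p3214}
             (proj₂ (Equivalence.to (T-∧ {admissible (prefix τ) (toℕ p)}) valid-τ))
    π≗ : π ≗ insertMax p τ
    π≗ = Equivalence.to T-≗ᵇ (proj₂ (Equivalence.to (T-∧ {valid}) t))
    in-Sav : inSavᵇ p1234 p3214 π ≡ valid
    in-Sav = trans (inSavᵇ-cong p1234 p3214 π≗) (inSavᵇ-insertMax p τ injτ)
    τ≗ : τ ≗ deleteMax π
    τ≗ j = sym (trans (deleteMax-cong π≗ j) (deleteMax-insertMax p τ j))
    p≡ : p ≡ maxPosition π
    p≡ = sym (trans (maxPosition-cong π≗) (maxPosition-insertMax p τ))

  insertMax-graph⇐ : T (inSavᵇ p1234 p3214 π ∧ inverse) → T (valid ∧ (π ≗ᵇ insertMax p τ))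
  insertMax-graph⇐ t = Equivalence.from T-∧ (subst T in-Sav valid-π , Equivalence.from T-≗ᵇ π≗)
    where
    valid-π : T (inSavᵇ p1234 p3214 π)
    valid-π = proj₁ (Equivalence.to T-∧ t)
    inverse-π : T inverse
    inverse-π = proj₂ (Equivalence.to (T-∧ {inSavᵇ p1234 p3214 π}) t)
    τ≗ : τ ≗ deleteMax π
    τ≗ = Equivalence.to T-≗ᵇ (proj₁ (Equivalence.to T-∧ inverse-π))
    p≡ : p ≡ maxPosition π
    p≡ = Equivalence.to T-≟ᵇ (proj₂ (Equivalence.to (T-∧ {τ ≗ᵇ deleteMax π}) inverse-π))
    injπ : IsPerm π
    injπ = IsPerm-of-inSavᵇ {σ₁ = p1234} {p3214} valid-π
    π≗ : π ≗ insertMax p τ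
    π≗ j = trans (insertMax-deleteMax π injπ j)
                 (trans (cong (λ q → insertMax q (deleteMax π) j) (sym p≡)) (insertMax-cong p (sym ∘ τ≗) j))
    in-Sav : inSavᵇ p1234 p3214 π ≡ valid
    in-Sav = trans (inSavᵇ-cong p1234 p3214 π≗)
                   (inSavᵇ-insertMax p τ (IsPerm-cong (sym ∘ τ≗) (deleteMax-injective π injπ)))

  insertMax-graph : (valid ∧ (π ≗ᵇ insertMax p τ)) ≡ (inSavᵇ p1234 p3214 π ∧ inverse)
  insertMax-graph = T-injective (mk⇔ insertMax-graph⇒ insertMax-graph⇐)

∑-insertMax : ∀ {k} (g : (Fin (5 ℕ.+ k) → Fin (5 ℕ.+ k)) → ℤ) → Respects _≗ᵇ_ g →
  ∑[ π ∈ allFuns (5 ℕ.+ k) (5 ℕ.+ k) ] 𝟙 (inSavᵇ p1234 p3214 π) * g π ≡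
  ∑[ τ ∈ allFuns (4 ℕ.+ k) (4 ℕ.+ k) ]
    (∑[ p ∈ allFin (5 ℕ.+ k) ] 𝟙 (admissible (prefix τ) (toℕ p) ∧ inSavᵇ p1234 p3214 τ) * g (insertMax p τ))
∑-insertMax {k} g resp = sym (∑-reindex-pairs (allFuns-enumerates _ _) (allFuns-enumerates _ _) (allFin-enumerates _)
  (inSavᵇ p1234 p3214) (λ τ p → admissible (prefix τ) (toℕ p) ∧ inSavᵇ p1234 p3214 τ) (λ τ p → insertMax p τ)
  deleteMax maxPosition insertMax-graph g resp)

-- The transfer operator

insertMaxᴵ : Fin 4 → Inversions₄ → Inversions₄
insertMaxᴵ 0F B = inversions true true true (i01 B) (i02 B) (i12 B)
insertMaxᴵ 1F B = inversions false (i01 B) (i02 B) true true (i12 B)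
insertMaxᴵ 2F B = inversions (i01 B) false (i02 B) false (i12 B) true
insertMaxᴵ 3F B = inversions (i01 B) (i02 B) false (i12 B) false false

module _ {k} (τ : Fin (4 ℕ.+ k) → Fin (4 ℕ.+ k)) where

  private
    t<n : ∀ j → word τ j < 4 ℕ.+ k
    t<n j = toℕ<n (τ j)

  prefix-insertMax₀ : prefix (insertMax 0F τ) ≡ insertMaxᴵ 0F (prefix τ)
  prefix-insertMax₀ rewrite word-insertMax-at 0F τ | word-insertMax-punchIn 0F τ 0F
                          | word-insertMax-punchIn 0F τ 1F | word-insertMax-punchIn 0F τ 2F =
    inversions₄-max₀ (t<n 0F) (t<n 1F) (t<n 2F)

  prefix-insertMax₁ : prefix (insertMax 1F τ) ≡ insertMaxᴵ 1F (prefix τ)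
  prefix-insertMax₁ rewrite word-insertMax-at 1F τ | word-insertMax-punchIn 1F τ 0F
                          | word-insertMax-punchIn 1F τ 1F | word-insertMax-punchIn 1F τ 2F =
    inversions₄-max₁ (t<n 0F) (t<n 1F) (t<n 2F)

  prefix-insertMax₂ : prefix (insertMax 2F τ) ≡ insertMaxᴵ 2F (prefix τ)
  prefix-insertMax₂ rewrite word-insertMax-at 2F τ | word-insertMax-punchIn 2F τ 0F
                          | word-insertMax-punchIn 2F τ 1F | word-insertMax-punchIn 2F τ 2F =
    inversions₄-max₂ (t<n 0F) (t<n 1F) (t<n 2F)

  prefix-insertMax₃ : prefix (insertMax 3F τ) ≡ insertMaxᴵ 3F (prefix τ)
  prefix-insertMax₃ rewrite word-insertMax-at 3F τ | word-insertMax-punchIn 3F τ 0F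
                          | word-insertMax-punchIn 3F τ 1F | word-insertMax-punchIn 3F τ 2F =
    inversions₄-max₃ (t<n 0F) (t<n 1F) (t<n 2F)

  prefix-insertMax₄ : prefix (insertMax 4F τ) ≡ prefix τ
  prefix-insertMax₄ rewrite word-insertMax-punchIn 4F τ 0F | word-insertMax-punchIn 4F τ 1F
                          | word-insertMax-punchIn 4F τ 2F | word-insertMax-punchIn 4F τ 3F = refl

-- The weight collected by τ when the maximum is inserted at each admissible position p = 0, …, 4,
-- whose sign changes (-1)^(4+k-p) alternate with p.
transfer : (Inversions₄ → ℤ) → Inversions₄ → ℤ
transfer W B = W (insertMaxᴵ 0F B) - W (insertMaxᴵ 1F B) + W (insertMaxᴵ 2F B)
             - 𝟙 (admissible B 3) * W (insertMaxᴵ 3F B) + 𝟙 (admissible B 4) * W B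

weightedCount : ℕ → (Inversions₄ → ℤ) → ℤ
weightedCount k W =
  ∑[ π ∈ allFuns (4 ℕ.+ k) (4 ℕ.+ k) ] 𝟙 (inSavᵇ p1234 p3214 π) * (sgn (inv π) * W (prefix π))

module _ {k} (W : Inversions₄ → ℤ) (τ : Fin (4 ℕ.+ k) → Fin (4 ℕ.+ k)) where

  private
    B : Inversions₄
    B = prefix τ
    v : Bool
    v = inSavᵇ p1234 p3214 τ
    x y : ℤ
    x = sgn (inv τ)
    y = sgn k

    beyond : Fin k → Fin (5 ℕ.+ k)
    beyond j = suc (suc (suc (suc (suc j))))

    term : Fin (5 ℕ.+ k) → ℤ
    term p = 𝟙 (admissible B (toℕ p) ∧ v) * (sgn (inv (insertMax p τ)) * W (prefix (insertMax p τ)))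

    sign-at : ∀ p → sgn (inv (insertMax p τ)) ≡ sgn ((4 ℕ.+ k) ∸ toℕ p) * x
    sign-at p = trans (cong sgn (inv-insertMax p τ)) (sgn-+ ((4 ℕ.+ k) ∸ toℕ p) (inv τ))

    term₀ : term 0F ≡ 𝟙 v * (y * x * W (insertMaxᴵ 0F B))
    term₀ = cong (𝟙 v *_) (cong₂ _*_ (trans (sign-at 0F) (cong (_* x) (trans (sgn-suc-suc (2 ℕ.+ k)) (sgn-suc-suc k))))
                                    (cong W (prefix-insertMax₀ τ)))
    term₁ : term 1F ≡ 𝟙 v * (ℤ.- y * x * W (insertMaxᴵ 1F B))
    term₁ = cong (𝟙 v *_) (cong₂ _*_ (trans (sign-at 1F) (cong (_* x) (trans (sgn-suc-suc (1 ℕ.+ k)) (sgn-suc k))))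
                                    (cong W (prefix-insertMax₁ τ)))
    term₂ : term 2F ≡ 𝟙 v * (y * x * W (insertMaxᴵ 2F B))
    term₂ = cong (𝟙 v *_) (cong₂ _*_ (trans (sign-at 2F) (cong (_* x) (sgn-suc-suc k)))
                                    (cong W (prefix-insertMax₂ τ)))
    term₃ : term 3F ≡ 𝟙 (admissible B 3) * 𝟙 v * (ℤ.- y * x * W (insertMaxᴵ 3F B))
    term₃ = cong₂ _*_ (𝟙-∧ (admissible B 3) v)
                      (cong₂ _*_ (trans (sign-at 3F) (cong (_* x) (sgn-suc k))) (cong W (prefix-insertMax₃ τ)))
    term₄ : term 4F ≡ 𝟙 (admissible B 4) * 𝟙 v * (y * x * W B)
    term₄ = cong₂ _*_ (𝟙-∧ (admissible B 4) v) (cong₂ _*_ (sign-at 4F) (cong W (prefix-insertMax₄ τ)))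

    rearrange : ∀ i a₃ a₄ x y w₀ w₁ w₂ w₃ w₄ →
      i * (y * x * w₀) + (i * (ℤ.- y * x * w₁) + (i * (y * x * w₂) +
        (a₃ * i * (ℤ.- y * x * w₃) + (a₄ * i * (y * x * w₄) + 0ℤ))))
      ≡ y * (i * (x * (w₀ - w₁ + w₂ - a₃ * w₃ + a₄ * w₄)))
    rearrange = solve-∀

  ∑-positions :
    ∑[ p ∈ allFin (5 ℕ.+ k) ] 𝟙 (admissible (prefix τ) (toℕ p) ∧ inSavᵇ p1234 p3214 τ) *
                               (sgn (inv (insertMax p τ)) * W (prefix (insertMax p τ)))
    ≡ sgn k * (𝟙 (inSavᵇ p1234 p3214 τ) * (sgn (inv τ) * transfer W (prefix τ)))
  ∑-positions = begin
    term 0F + (term 1F + (term 2F + (term 3F + (term 4F + (∑[ p ∈ tabulate beyond ] term p)))))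
      ≡⟨ cong₂ _+_ term₀ (cong₂ _+_ term₁ (cong₂ _+_ term₂ (cong₂ _+_ term₃
           (cong₂ _+_ term₄ (∑-tabulate-zero {h = beyond} term (λ _ → refl)))))) ⟩
    _ ≡⟨ rearrange (𝟙 v) (𝟙 (admissible B 3)) (𝟙 (admissible B 4)) x y _ _ _ _ _ ⟩
    y * (𝟙 v * (x * transfer W B)) ∎

weightedCount-step : ∀ k W → weightedCount (suc k) W ≡ sgn k * weightedCount k (transfer W)
weightedCount-step k W = begin
  ∑[ π ∈ allFuns (5 ℕ.+ k) (5 ℕ.+ k) ] 𝟙 (inSavᵇ p1234 p3214 π) * g π
    ≡⟨ ∑-insertMax {k} g (λ {π} {π′} → g-respects {π} {π′}) ⟩
  ∑[ τ ∈ allFuns (4 ℕ.+ k) (4 ℕ.+ k) ]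
    (∑[ p ∈ allFin (5 ℕ.+ k) ] 𝟙 (admissible (prefix τ) (toℕ p) ∧ inSavᵇ p1234 p3214 τ) * g (insertMax p τ))
    ≡⟨ ∑-cong (allFuns (4 ℕ.+ k) (4 ℕ.+ k)) (∑-positions W) ⟩
  ∑[ τ ∈ allFuns (4 ℕ.+ k) (4 ℕ.+ k) ] sgn k * (𝟙 (inSavᵇ p1234 p3214 τ) * (sgn (inv τ) * transfer W (prefix τ)))
    ≡⟨ ∑-distribˡ-* (allFuns (4 ℕ.+ k) (4 ℕ.+ k)) (sgn k) _ ⟩
  sgn k * weightedCount k (transfer W) ∎
  where
  g : (Fin (5 ℕ.+ k) → Fin (5 ℕ.+ k)) → ℤ
  g π = sgn (inv π) * W (prefix π)
  g-respects : Respects _≗ᵇ_ g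
  g-respects {π} {π′} t = cong₂ _*_ (cong sgn (inv-cong π≗π′)) (cong W prefix≡)
    where
    π≗π′ : π ≗ π′
    π≗π′ = Equivalence.to T-≗ᵇ t
    prefix≡ : prefix π ≡ prefix π′
    prefix≡ rewrite π≗π′ 0F | π≗π′ 1F | π≗π′ 2F | π≗π′ 3F = refl

record Every (Q : Bool → Set) : Set where
  constructor both
  field
    at-true  : Q true
    at-false : Q false

every-elim : ∀ {Q} → Every Q → ∀ b → Q b
every-elim e true  = Every.at-true e
every-elim e false = Every.at-false e

-- When each P B is decided by evaluation, Exhaustively P is a record of 64 copies of ⊤,
-- so it is inhabited by the wildcard term.
Exhaustively : (Inversions₄ → Set) → Set
Exhaustively P =
  Every λ a → Every λ b → Every λ c → Every λ d → Every λ e → Every λ f → P (inversions a b c d e f)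

by-exhaustion : ∀ {P} → Exhaustively P → ∀ B → P B
by-exhaustion t (inversions a b c d e f) =
  every-elim (every-elim (every-elim (every-elim (every-elim (every-elim t a) b) c) d) e) f

≗-by-exhaustion : (V V′ : Inversions₄ → ℤ) → Exhaustively (λ B → True (V B ℤ.≟ V′ B)) → ∀ B → V B ≡ V′ B
≗-by-exhaustion V V′ t B = toWitness (by-exhaustion t B)

-- W₃ records that the first four entries contain no monotone triple; W₂ adds the indicator that
-- the first three entries are monotone.
W₁ W₂ W₃ : Inversions₄ → ℤ
W₁ B = 1ℤ
W₂ B = 𝟙 (not (admissible B 3)) + 𝟙 (admissible B 4)
W₃ B = 𝟙 (admissible B 4)

transfer-W₁ : ∀ B → transfer W₁ B ≡ W₂ B
transfer-W₁ = ≗-by-exhaustion (transfer W₁) W₂ _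

transfer-W₂ : ∀ B → transfer W₂ B ≡ W₁ B + W₃ B
transfer-W₂ = ≗-by-exhaustion (transfer W₂) (λ B → W₁ B + W₃ B) _

transfer-W₃ : ∀ B → transfer W₃ B ≡ W₃ B
transfer-W₃ = ≗-by-exhaustion (transfer W₃) W₃ _

weightedCount-cong : ∀ k {W W′ : Inversions₄ → ℤ} → (∀ B → W B ≡ W′ B) → weightedCount k W ≡ weightedCount k W′
weightedCount-cong k W≗W′ = ∑-cong (allFuns (4 ℕ.+ k) (4 ℕ.+ k))
  λ π → cong (λ w → 𝟙 (inSavᵇ p1234 p3214 π) * (sgn (inv π) * w)) (W≗W′ (prefix π))

weightedCount-+ : ∀ k (W W′ : Inversions₄ → ℤ) →
  weightedCount k (λ B → W B + W′ B) ≡ weightedCount k W + weightedCount k W′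
weightedCount-+ k W W′ = trans (∑-cong (allFuns (4 ℕ.+ k) (4 ℕ.+ k)) split) (∑-distrib-+ (allFuns (4 ℕ.+ k) (4 ℕ.+ k)) _ _)
  where
  split : ∀ π → 𝟙 (inSavᵇ p1234 p3214 π) * (sgn (inv π) * (W (prefix π) + W′ (prefix π))) ≡
                𝟙 (inSavᵇ p1234 p3214 π) * (sgn (inv π) * W (prefix π)) +
                𝟙 (inSavᵇ p1234 p3214 π) * (sgn (inv π) * W′ (prefix π))
  split π = distrib (𝟙 (inSavᵇ p1234 p3214 π)) (sgn (inv π)) (W (prefix π)) (W′ (prefix π))
    where
    distrib : ∀ a s w w′ → a * (s * (w + w′)) ≡ a * (s * w) + a * (s * w′)
    distrib = solve-∀

weightedCount-vanishes : ∀ k → weightedCount k W₁ ≡ 0ℤ × weightedCount k W₂ ≡ 0ℤ × weightedCount k W₃ ≡ 0ℤ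
weightedCount-vanishes zero = refl , refl , refl
weightedCount-vanishes (suc k) with weightedCount-vanishes k
... | zero₁ , zero₂ , zero₃ =
  step W₁ (trans (weightedCount-cong k transfer-W₁) zero₂) ,
  step W₂ (trans (weightedCount-cong k transfer-W₂)
                 (trans (weightedCount-+ k W₁ W₃) (cong₂ _+_ zero₁ zero₃))) ,
  step W₃ (trans (weightedCount-cong k transfer-W₃) zero₃)
  where
  step : ∀ W → weightedCount k (transfer W) ≡ 0ℤ → weightedCount (suc k) W ≡ 0ℤ
  step W vanishes = trans (weightedCount-step k W) (trans (cong (sgn k *_) vanishes) (ℤ.*-zeroʳ (sgn k)))

signedCount-1234-3214 : ∀ n → 1 < n → signedCount n p1234 p3214 ≡ 0ℤ
signedCount-1234-3214 (suc zero)                       (s≤s ())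
signedCount-1234-3214 (suc (suc zero))                 _ = refl
signedCount-1234-3214 (suc (suc (suc zero)))           _ = refl
signedCount-1234-3214 (suc (suc (suc (suc k))))        _ =
  trans (∑-cong (allFuns (4 ℕ.+ k) (4 ℕ.+ k))
                (λ π → cong (𝟙 (inSavᵇ p1234 p3214 π) *_) (sym (ℤ.*-identityʳ (sgn (inv π))))))
        (proj₁ (weightedCount-vanishes k))

p4321 p4123 p2341 p1432 : Word 4
p4321 = pat 4 3 2 1
p4123 = pat 4 1 2 3
p2341 = pat 2 3 4 1
p1432 = pat 1 4 3 2

signedCount-4321-4123 : ∀ n → 1 < n → signedCount n p4321 p4123 ≡ 0ℤ
signedCount-4321-4123 n 1<n = trans
  (signedCount-reverse n p4321 p4123 p1234 p3214 (Reverses-by-eval p1234 p4321) (Reverses-by-eval p4321 p1234)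
                                                 (Reverses-by-eval p3214 p4123) (Reverses-by-eval p4123 p3214))
  (*-annihilates (sgn (pairs n)) (signedCount-1234-3214 n 1<n))

signedCount-4321-2341 : ∀ n → 1 < n → signedCount n p4321 p2341 ≡ 0ℤ
signedCount-4321-2341 n 1<n = trans
  (signedCount-complement n p4321 p2341 p1234 p3214 (Complements-by-eval p1234 p4321) (Complements-by-eval p4321 p1234)
                                                    (Complements-by-eval p3214 p2341) (Complements-by-eval p2341 p3214))
  (*-annihilates (sgn (pairs n)) (signedCount-1234-3214 n 1<n))

signedCount-1234-1432 : ∀ n → 1 < n → signedCount n p1234 p1432 ≡ 0ℤ
signedCount-1234-1432 n 1<n = trans
  (signedCount-complement n p1234 p1432 p4321 p4123 (Complements-by-eval p4321 p1234) (Complements-by-eval p1234 p4321)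
                                                    (Complements-by-eval p4123 p1432) (Complements-by-eval p1432 p4123))
  (*-annihilates (sgn (pairs n)) (signedCount-4321-4123 n 1<n))

proposition3p5 : (n : ℕ) → 1 < n →
    SignBalanced (Sav n (pat 1 2 3 4) (pat 3 2 1 4))
    × SignBalanced (Sav n (pat 4 3 2 1) (pat 4 1 2 3))
    × SignBalanced (Sav n (pat 4 3 2 1) (pat 2 3 4 1))
    × SignBalanced (Sav n (pat 1 2 3 4) (pat 1 4 3 2))
proposition3p5 n 1<n =
  SignBalanced-Sav n p1234 p3214 (signedCount-1234-3214 n 1<n) ,
  SignBalanced-Sav n p4321 p4123 (signedCount-4321-4123 n 1<n) ,
  SignBalanced-Sav n p4321 p2341 (signedCount-4321-2341 n 1<n) ,
  SignBalanced-Sav n p1234 p1432 (signedCount-1234-1432 n 1<n)
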